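{- A graph $G$ on $n$ vertices with degree sequence $d_1,\dots,d_n$ is a tree if and only if \[ \pi_G^{(P_2)}(k)=\binom{k}{2}\sum_{i=1}^n (k-2)^{d_i}(k-1)^{n-d_i-1} \] (as polynomials in $k$).
   Context: Graphs are finite and simple. For $k\in\mathbb{N}$, $\mathcal{C}_k(G)$ is the graph whose vertices are the proper colorings $V(G)\to\{1,\dots,k\}$, two adjacent iff they differ on exactly one vertex of $G$. The chromatic pairs polynomial $\pi_G^{(P_2)}(k)$ is the number of edges of $\mathcal{C}_k(G)$. -}

module Defs where

open import Data.Bool using (Bool; true; false; not; _∧_; _∨_; if_then_else_)
open import Data.Nat using (ℕ; zero; suc; _+_; _*_; _∸_; _^_; _/_; _≤_)
open import Data.Fin using (Fin; zero; suc; inject₁; fromℕ)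
open import Data.Fin.Properties using (_≟_)
open import Data.List using (List; []; _∷_; map; concatMap; allFin; length; filterᵇ)
open import Data.Bool.ListAction using (and)
open import Data.Product using (Σ; _×_; _,_)
open import Function.Definitions using (Injective)
open import Relation.Nullary.Decidable using (⌊_⌋)
open import Relation.Binary.PropositionalEquality using (_≡_)

record Graph (n : ℕ) : Set where
  field
    adj    : Fin n → Fin n → Bool
    sym    : ∀ i j → adj i j ≡ adj j i
    irrefl : ∀ i → adj i i ≡ false
open Graph public

degree : ∀ {n} → Graph n → Fin n → ℕ
degree {n} G i = length (filterᵇ (adj G i) (allFin n))

data Walk {n} (G : Graph n) : Fin n → Fin n → Set where
  here : ∀ {i} → Walk G i i
  step : ∀ {i j l} → adj G i j ≡ true → Walk G j l → Walk G i l

Connected : ∀ {n} → Graph n → Set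
Connected G = ∀ i j → Walk G i j

-- A cycle of length m+3: distinct vertices v_0,…,v_{m+2}, consecutive ones
-- adjacent, and v_{m+2} adjacent to v_0.
record Cycle {n} (G : Graph n) : Set where
  field
    len  : ℕ
    vert : Fin (suc (suc (suc len))) → Fin n
    inj  : Injective _≡_ _≡_ vert
    cons : ∀ (i : Fin (suc (suc len))) → adj G (vert (inject₁ i)) (vert (suc i)) ≡ true
    close : adj G (vert (fromℕ (suc (suc len)))) (vert zero) ≡ true

Acyclic : ∀ {n} → Graph n → Set
Acyclic G = Cycle G → Data.Empty.⊥
  where import Data.Empty

IsTree : ∀ {n} → Graph n → Set
IsTree G = Connected G × Acyclic G

allMaps : ∀ n k → List (Fin n → Fin k)
allMaps zero    k = (λ ()) ∷ []
allMaps (suc n) k = concatMap (λ a → map (λ f → λ { zero → a ; (suc i) → f i }) (allMaps n k)) (allFin k)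

_==_ : ∀ {k} → Fin k → Fin k → Bool
a == b = ⌊ a ≟ b ⌋

isProper : ∀ {n k} → Graph n → (Fin n → Fin k) → Bool
isProper {n} G c = and (map (λ i → and (map (λ j → not (adj G i j) ∨ not (c i == c j)) (allFin n))) (allFin n))

properColorings : ∀ {n} → Graph n → (k : ℕ) → List (Fin n → Fin k)
properColorings {n} G k = filterᵇ (isProper G) (allMaps n k)

diffCount : ∀ {n k} → (Fin n → Fin k) → (Fin n → Fin k) → ℕ
diffCount {n} c d = length (filterᵇ (λ i → not (c i == d i)) (allFin n))

isOne : ℕ → Bool
isOne (suc zero) = true
isOne _ = false

orderedAdjPairs : ∀ {n} → Graph n → ℕ → ℕ
orderedAdjPairs G k =
  length (concatMap (λ c → filterᵇ (λ d → isOne (diffCount c d)) (properColorings G k)) (properColorings G k))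

-- chromatic pairs polynomial π_G^{(P_2)}(k): number of (unordered) edges of C_k(G)
chromaticPairs : ∀ {n} → Graph n → ℕ → ℕ
chromaticPairs G k = orderedAdjPairs G k / 2

{-# OPTIONS --safe #-}
module Submission where

-- An edge c — c[v ↦ b] of 𝒞ₖ(G) is determined by v and the ordered pair of colours (c v , b). Permuting colours shows
-- that all k(k-1) pairs contribute equally, so π(k) = C(k,2) ∑ᵥ Nᵥ(k), where Nᵥ(k) counts the proper colourings with
-- c v = 0 in which v can be recoloured 1. Fix a breadth-first spanning tree rooted at v, so that the neighbours of v
-- are its children. Colouring down the tree, the colourings that respect only the tree edges and keep the neighbours
-- of v off colour 1 number (k-2)^dᵥ (k-1)^(n-dᵥ-1); they include those counted by Nᵥ(k), and all of them are counted
-- when G is a tree. If G has a cycle, an edge outside the tree makes the inequality strict for k = n + 4. If G is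
-- disconnected, permuting colours on a component missing v shows k ∣ Nᵥ(k), whereas for k = 2 + ∑ᵥ 2^dᵥ the sum
-- ∑ᵥ (k-2)^dᵥ (k-1)^(n-dᵥ-1) is ≡ ±∑ᵥ 2^dᵥ = ±(k-2) modulo k.

open import Defs hiding (sym)
open import Data.Bool using (Bool; true; false; not; _∧_; _∨_; if_then_else_)
open import Data.Bool.ListAction using (and)
open import Data.Bool.Properties using (not-involutive; ∧-identityʳ)
import Data.Bool.Properties as Bool
open import Data.Empty using (⊥; ⊥-elim)
open import Data.Fin using (Fin; zero; suc; toℕ; fromℕ; fromℕ<; inject₁)
open import Data.Fin.Permutation using (Permutation′; transpose; _⟨$⟩ʳ_; _⟨$⟩ˡ_; flip; inverseˡ; inverseʳ)
open import Data.Fin.Properties using (_≟_; suc-injective; any?; pigeonhole; toℕ-fromℕ<; toℕ-injective; toℕ-inject₁; toℕ<n)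
import Data.Fin.Properties as Fin
open import Data.Fin.Relation.Unary.Top using (view; ‵fromℕ; ‵inject₁)
open import Data.List using (List; []; _∷_; map; concatMap; allFin; length; filterᵇ; _++_)
import Data.List as L
import Data.List.Properties as LP
open import Data.List.Relation.Unary.Linked using (Linked; []; [-]; _∷_)
import Data.List.Relation.Unary.Linked as Linked
open import Data.Nat using (ℕ; zero; suc; pred; _+_; _*_; _∸_; _^_; _≤_; _<_; _≤′_; ≤′-refl; ≤′-step; z≤n; s≤s; _≤?_; >-nonZero)
open import Data.Nat.Combinatorics using (_C_; nCk+nC[k+1]≡[n+1]C[k+1]; nC1≡n)
open import Data.Nat.DivMod using (_/_; m*n/n≡m)
open import Data.Nat.Divisibility using (_∣_; divides; _∣0; ∣m∣n⇒∣m+n; ∣m+n∣m⇒∣n; m∣m*n; ∣n⇒∣m*n; ∣⇒≤)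
open import Data.Nat.ListAction using (sum)
open import Data.Nat.ListAction.Properties using (sum-++)
open import Data.Nat.Properties using
  ( *-assoc; *-cancelˡ-≡; *-comm; *-distribˡ-+; *-identityʳ; *-identityˡ; *-zeroʳ; +-cancelˡ-≡; +-comm; +-identityʳ
  ; +-mono-<-≤; +-mono-≤; +-mono-≤-<; <-irrefl; <-≤-trans; <⇒≢; <⇒≤; <⇒≱; ^-distribˡ-+-*; ^-zeroˡ; m+[n∸m]≡n
  ; m+n∸n≡m; m<m+n; m<n+m; m<n⇒0<n∸m; m^n>0; m≤m+n; m≤n⇒m<n∨m≡n; m≤n⇒m≤1+n; n≤0⇒n≡0; n≤1+n; pred[n]≤n
  ; ≤-pred; ≤-refl; ≤-reflexive; ≤-trans; ≤⇒≤′; ≤⇒≯; ≮⇒≥; ≰⇒>; module ≤-Reasoning)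
open import Data.Nat.Solver using (module +-*-Solver)
open import Data.Product using (_×_; _,_; proj₁; proj₂; ∃; ∃₂)
open import Data.Sum using (_⊎_; inj₁; inj₂; [_,_]′)
import Data.Sum as Sum
open import Function using (_∘_; id)
open import Function.Bundles using (_⇔_; mk⇔)
open import Relation.Binary.Construct.Closure.ReflexiveTransitive using (Star; ε; _◅_; _◅◅_; reverse)
open import Relation.Binary.PropositionalEquality
open import Relation.Nullary using (¬_; Dec; yes; no; ¬?; contradiction)
open import Relation.Nullary.Decidable using (dec-true; dec-false; _×-dec_; _⊎-dec_)
open +-*-Solver using (solve; _:*_; _:+_; _:=_; con)

𝟙 : Bool → ℕ
𝟙 true  = 1
𝟙 false = 0

𝟙-∧ : ∀ a b → 𝟙 (a ∧ b) ≡ 𝟙 a * 𝟙 b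
𝟙-∧ true  b = sym (+-identityʳ (𝟙 b))
𝟙-∧ false b = refl

𝟙-mono : ∀ {a b} → (a ≡ true → b ≡ true) → 𝟙 a ≤ 𝟙 b
𝟙-mono {false} _   = z≤n
𝟙-mono {true}  a⇒b rewrite a⇒b refl = ≤-refl

⇔-true⇒≡ : ∀ {a b} → (a ≡ true → b ≡ true) → (b ≡ true → a ≡ true) → a ≡ b
⇔-true⇒≡ {false} {false} _ _ = refl
⇔-true⇒≡ {false} {true}  _ b⇒a = b⇒a refl
⇔-true⇒≡ {true}  {_}     a⇒b _ = sym (a⇒b refl)

∧-true⁻ : ∀ {a b} → a ∧ b ≡ true → a ≡ true × b ≡ true
∧-true⁻ {true} {true} _ = refl , refl

∨-true⁻ : ∀ {a b} → a ∨ b ≡ true → a ≡ true ⊎ b ≡ true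
∨-true⁻ {true}  _ = inj₁ refl
∨-true⁻ {false} b = inj₂ b

∑ : {A : Set} → List A → (A → ℕ) → ℕ
∑ xs f = sum (map f xs)

module _ {A : Set} where

  ∑-cong : ∀ (xs : List A) {f g : A → ℕ} → (∀ x → f x ≡ g x) → ∑ xs f ≡ ∑ xs g
  ∑-cong xs f≗g = cong sum (LP.map-cong f≗g xs)

  ∑-zero : ∀ (xs : List A) → ∑ xs (λ _ → 0) ≡ 0
  ∑-zero []       = refl
  ∑-zero (_ ∷ xs) = ∑-zero xs

  ∑-+ : ∀ (xs : List A) (f g : A → ℕ) → ∑ xs (λ x → f x + g x) ≡ ∑ xs f + ∑ xs g
  ∑-+ []       f g = refl
  ∑-+ (x ∷ xs) f g rewrite ∑-+ xs f g =
    solve 4 (λ a b c d → a :+ b :+ (c :+ d) := a :+ c :+ (b :+ d)) refl (f x) (g x) (∑ xs f) (∑ xs g)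

  ∑-*ˡ : ∀ (xs : List A) c (f : A → ℕ) → c * ∑ xs f ≡ ∑ xs (λ x → c * f x)
  ∑-*ˡ []       c f = *-zeroʳ c
  ∑-*ˡ (x ∷ xs) c f = trans (*-distribˡ-+ c (f x) (∑ xs f)) (cong (c * f x +_) (∑-*ˡ xs c f))

  ∑-*ʳ : ∀ (xs : List A) c (f : A → ℕ) → ∑ xs f * c ≡ ∑ xs (λ x → f x * c)
  ∑-*ʳ xs c f = trans (*-comm (∑ xs f) c) (trans (∑-*ˡ xs c f) (∑-cong xs (λ x → *-comm c (f x))))

  ∑-mono-≤ : ∀ (xs : List A) {f g : A → ℕ} → (∀ x → f x ≤ g x) → ∑ xs f ≤ ∑ xs g
  ∑-mono-≤ []       _   = z≤n
  ∑-mono-≤ (x ∷ xs) f≤g = +-mono-≤ (f≤g x) (∑-mono-≤ xs f≤g)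

  ∑-++ : ∀ (xs ys : List A) (f : A → ℕ) → ∑ (xs ++ ys) f ≡ ∑ xs f + ∑ ys f
  ∑-++ xs ys f = trans (cong sum (LP.map-++ f xs ys)) (sum-++ (map f xs) (map f ys))

  ∑-filterᵇ : ∀ (p : A → Bool) (xs : List A) (f : A → ℕ) → ∑ (filterᵇ p xs) f ≡ ∑ xs (λ x → 𝟙 (p x) * f x)
  ∑-filterᵇ p []       f = refl
  ∑-filterᵇ p (x ∷ xs) f with p x
  ... | true  = cong₂ _+_ (sym (+-identityʳ (f x))) (∑-filterᵇ p xs f)
  ... | false = ∑-filterᵇ p xs f

  length≡∑ : ∀ (xs : List A) → length xs ≡ ∑ xs (λ _ → 1)
  length≡∑ []       = refl
  length≡∑ (_ ∷ xs) = cong suc (length≡∑ xs)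

  ∑-∣ : ∀ (xs : List A) {d} {f : A → ℕ} → (∀ x → d ∣ f x) → d ∣ ∑ xs f
  ∑-∣ []       {d} _   = d ∣0
  ∑-∣ (x ∷ xs)     d∣f = ∣m∣n⇒∣m+n (d∣f x) (∑-∣ xs d∣f)

  length-filterᵇ : ∀ (p : A → Bool) (xs : List A) → length (filterᵇ p xs) ≡ ∑ xs (𝟙 ∘ p)
  length-filterᵇ p xs = trans (length≡∑ (filterᵇ p xs)) (trans (∑-filterᵇ p xs (λ _ → 1)) (∑-cong xs (λ x → *-identityʳ (𝟙 (p x)))))

∑-concatMap : ∀ {A B : Set} (g : A → List B) (xs : List A) (f : B → ℕ) →
  ∑ (concatMap g xs) f ≡ ∑ xs (λ x → ∑ (g x) f)
∑-concatMap g []       f = refl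
∑-concatMap g (x ∷ xs) f = trans (∑-++ (g x) (concatMap g xs) f) (cong (∑ (g x) f +_) (∑-concatMap g xs f))

∑-comm : ∀ {A B : Set} (xs : List A) (ys : List B) (f : A → B → ℕ) →
  ∑ xs (λ x → ∑ ys (f x)) ≡ ∑ ys (λ y → ∑ xs (λ x → f x y))
∑-comm []       ys f = sym (∑-zero ys)
∑-comm (x ∷ xs) ys f =
  trans (cong (∑ ys (f x) +_) (∑-comm xs ys f)) (sym (∑-+ ys (f x) (λ y → ∑ xs (λ x′ → f x′ y))))

length-concatMap : ∀ {A B : Set} (g : A → List B) (xs : List A) → length (concatMap g xs) ≡ ∑ xs (length ∘ g)
length-concatMap g xs = trans (length≡∑ (concatMap g xs)) (trans (∑-concatMap g xs _) (∑-cong xs (sym ∘ length≡∑ ∘ g)))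

∑-map : ∀ {A B : Set} (h : A → B) (xs : List A) (f : B → ℕ) → ∑ (map h xs) f ≡ ∑ xs (f ∘ h)
∑-map h xs f = cong sum (sym (LP.map-∘ xs))

∑ᶠ : (n : ℕ) → (Fin n → ℕ) → ℕ
∑ᶠ n = ∑ (allFin n)

∑ᶠ-suc : ∀ n (f : Fin (suc n) → ℕ) → ∑ᶠ (suc n) f ≡ f zero + ∑ᶠ n (f ∘ suc)
∑ᶠ-suc n f = cong (λ xs → f zero + sum xs) (trans (LP.map-tabulate suc f) (sym (LP.map-tabulate id (f ∘ suc))))

∑ᶠ-const : ∀ n c → ∑ᶠ n (λ _ → c) ≡ n * c
∑ᶠ-const zero    c = refl
∑ᶠ-const (suc n) c = trans (∑ᶠ-suc n (λ _ → c)) (cong (c +_) (∑ᶠ-const n c))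

∑ᶠ-mono-< : ∀ n {f g : Fin n → ℕ} → (∀ i → f i ≤ g i) → ∀ i → f i < g i → ∑ᶠ n f < ∑ᶠ n g
∑ᶠ-mono-< (suc n) {f} {g} f≤g zero    f<g = subst₂ _<_ (sym (∑ᶠ-suc n f)) (sym (∑ᶠ-suc n g))
  (+-mono-<-≤ f<g (∑-mono-≤ (allFin n) (f≤g ∘ suc)))
∑ᶠ-mono-< (suc n) {f} {g} f≤g (suc i) f<g = subst₂ _<_ (sym (∑ᶠ-suc n f)) (sym (∑ᶠ-suc n g))
  (+-mono-≤-< (f≤g zero) (∑ᶠ-mono-< n (f≤g ∘ suc) i f<g))

∑ᶠ-positive : ∀ n {f : Fin n → ℕ} → 1 ≤ n → (∀ i → 0 < f i) → 0 < ∑ᶠ n f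
∑ᶠ-positive (suc n) {f} _ f>0 = subst (0 <_) (sym (∑ᶠ-suc n f)) (<-≤-trans (f>0 zero) (m≤m+n (f zero) _))

∏ᶠ : (n : ℕ) → (Fin n → ℕ) → ℕ
∏ᶠ zero    f = 1
∏ᶠ (suc n) f = f zero * ∏ᶠ n (f ∘ suc)

∏ᶠ-cong : ∀ n {f g : Fin n → ℕ} → (∀ i → f i ≡ g i) → ∏ᶠ n f ≡ ∏ᶠ n g
∏ᶠ-cong zero    _   = refl
∏ᶠ-cong (suc n) f≗g = cong₂ _*_ (f≗g zero) (∏ᶠ-cong n (f≗g ∘ suc))

∏ᶠ-^ : ∀ n a b (p q : Fin n → Bool) → ∏ᶠ n (λ i → a ^ 𝟙 (p i) * b ^ 𝟙 (q i)) ≡ a ^ ∑ᶠ n (𝟙 ∘ p) * b ^ ∑ᶠ n (𝟙 ∘ q)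
∏ᶠ-^ zero    a b p q = refl
∏ᶠ-^ (suc n) a b p q = begin
  a ^ 𝟙 (p zero) * b ^ 𝟙 (q zero) * ∏ᶠ n (λ i → a ^ 𝟙 (p (suc i)) * b ^ 𝟙 (q (suc i)))
    ≡⟨ cong (a ^ 𝟙 (p zero) * b ^ 𝟙 (q zero) *_) (∏ᶠ-^ n a b (p ∘ suc) (q ∘ suc)) ⟩
  a ^ 𝟙 (p zero) * b ^ 𝟙 (q zero) * (a ^ P * b ^ Q)
    ≡⟨ solve 4 (λ w x y z → w :* x :* (y :* z) := (w :* y) :* (x :* z)) refl (a ^ 𝟙 (p zero)) (b ^ 𝟙 (q zero)) (a ^ P) (b ^ Q) ⟩
  (a ^ 𝟙 (p zero) * a ^ P) * (b ^ 𝟙 (q zero) * b ^ Q)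
    ≡⟨ cong₂ _*_ (sym (^-distribˡ-+-* a (𝟙 (p zero)) P)) (sym (^-distribˡ-+-* b (𝟙 (q zero)) Q)) ⟩
  a ^ (𝟙 (p zero) + P) * b ^ (𝟙 (q zero) + Q)
    ≡⟨ cong₂ (λ x y → a ^ x * b ^ y) (sym (∑ᶠ-suc n (𝟙 ∘ p))) (sym (∑ᶠ-suc n (𝟙 ∘ q))) ⟩
  a ^ ∑ᶠ (suc n) (𝟙 ∘ p) * b ^ ∑ᶠ (suc n) (𝟙 ∘ q) ∎
  where
  open ≡-Reasoning
  P = ∑ᶠ n (𝟙 ∘ p ∘ suc)
  Q = ∑ᶠ n (𝟙 ∘ q ∘ suc)

allᶠ : (n : ℕ) → (Fin n → Bool) → Bool
allᶠ zero    p = true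
allᶠ (suc n) p = p zero ∧ allᶠ n (p ∘ suc)

∏ᶠ-𝟙 : ∀ n (p : Fin n → Bool) → ∏ᶠ n (𝟙 ∘ p) ≡ 𝟙 (allᶠ n p)
∏ᶠ-𝟙 zero    p = refl
∏ᶠ-𝟙 (suc n) p = trans (cong (𝟙 (p zero) *_) (∏ᶠ-𝟙 n (p ∘ suc))) (sym (𝟙-∧ (p zero) _))

≟-elim : ∀ {ℓ} {P : Set ℓ} {n} (a b : Fin n) → (a ≡ b → P) → (a ≢ b → P) → P
≟-elim a b yes-case no-case with a ≟ b
... | yes a≡b = yes-case a≡b
... | no  a≢b = no-case a≢b

==-refl : ∀ {k} (a : Fin k) → (a == a) ≡ true
==-refl a with a ≟ a
... | yes _   = refl
... | no  a≢a = ⊥-elim (a≢a refl)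

≢⇒==false : ∀ {k} {a b : Fin k} → a ≢ b → (a == b) ≡ false
≢⇒==false {a = a} {b} a≢b with a ≟ b
... | yes a≡b = ⊥-elim (a≢b a≡b)
... | no  _   = refl

==⇒≡ : ∀ {k} {a b : Fin k} → (a == b) ≡ true → a ≡ b
==⇒≡ {a = a} {b} a==b with a ≟ b
... | yes a≡b = a≡b

==-sym : ∀ {k} (a b : Fin k) → (a == b) ≡ (b == a)
==-sym a b with a ≟ b
... | yes refl = sym (==-refl a)
... | no  a≢b  = sym (≢⇒==false (a≢b ∘ sym))

suc-== : ∀ {k} (a b : Fin k) → (suc a == suc b) ≡ (a == b)
suc-== a b = ≟-elim a b (λ { refl → trans (==-refl (suc a)) (sym (==-refl a)) })
  (λ a≢b → trans (≢⇒==false (a≢b ∘ suc-injective)) (sym (≢⇒==false a≢b)))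

∑ᶠ-δ : ∀ k (b : Fin k) (f : Fin k → ℕ) → ∑ᶠ k (λ a → 𝟙 (a == b) * f a) ≡ f b
∑ᶠ-δ (suc k) zero f = begin
  ∑ᶠ (suc k) (λ a → 𝟙 (a == zero) * f a)          ≡⟨ ∑ᶠ-suc k (λ a → 𝟙 (a == zero) * f a) ⟩
  𝟙 (zero == zero {n = k}) * f zero + ∑ᶠ k (λ a → 𝟙 (suc a == zero) * f (suc a))
    ≡⟨ cong₂ (λ x y → 𝟙 x * f zero + y) (==-refl {suc k} zero)
             (trans (∑-cong (allFin k) (λ a → cong (λ x → 𝟙 x * f (suc a)) (≢⇒==false {a = suc a} {b = zero} λ ()))) (∑-zero (allFin k))) ⟩
  f zero + 0 + 0                                   ≡⟨ cong (_+ 0) (+-identityʳ (f zero)) ⟩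
  f zero + 0                                       ≡⟨ +-identityʳ (f zero) ⟩
  f zero ∎
  where open ≡-Reasoning
∑ᶠ-δ (suc k) (suc b) f = begin
  ∑ᶠ (suc k) (λ a → 𝟙 (a == suc b) * f a)          ≡⟨ ∑ᶠ-suc k (λ a → 𝟙 (a == suc b) * f a) ⟩
  𝟙 (zero == suc b) * f zero + ∑ᶠ k (λ a → 𝟙 (suc a == suc b) * f (suc a))
    ≡⟨ cong₂ (λ x y → 𝟙 x * f zero + y) (≢⇒==false {a = zero} {b = suc b} λ ())
             (∑-cong (allFin k) (λ a → cong (λ x → 𝟙 x * f (suc a)) (suc-== a b))) ⟩
  ∑ᶠ k (λ a → 𝟙 (a == b) * f (suc a))              ≡⟨ ∑ᶠ-δ k b (f ∘ suc) ⟩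
  f (suc b) ∎
  where open ≡-Reasoning

count-== : ∀ k (b : Fin k) → ∑ᶠ k (λ a → 𝟙 (a == b)) ≡ 1
count-== k b = trans (∑-cong (allFin k) (λ a → sym (*-identityʳ (𝟙 (a == b))))) (∑ᶠ-δ k b (λ _ → 1))

count-≢ : ∀ k (b : Fin k) → ∑ᶠ k (λ a → 𝟙 (not (a == b))) ≡ k ∸ 1
count-≢ k b = begin
  X                                  ≡⟨ sym (m+n∸n≡m X 1) ⟩
  X + 1 ∸ 1                          ≡⟨ cong (λ y → X + y ∸ 1) (sym (count-== k b)) ⟩
  X + ∑ᶠ k (λ a → 𝟙 (a == b)) ∸ 1    ≡⟨ cong (_∸ 1) (sym (∑-+ (allFin k) _ _)) ⟩
  ∑ᶠ k (λ a → 𝟙 (not (a == b)) + 𝟙 (a == b)) ∸ 1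
    ≡⟨ cong (_∸ 1) (trans (∑-cong (allFin k) (λ a → 𝟙-not+𝟙 (a == b))) (trans (∑ᶠ-const k 1) (*-identityʳ k))) ⟩
  k ∸ 1 ∎
  where
  open ≡-Reasoning
  X = ∑ᶠ k (λ a → 𝟙 (not (a == b)))
  𝟙-not+𝟙 : ∀ x → 𝟙 (not x) + 𝟙 x ≡ 1
  𝟙-not+𝟙 true  = refl
  𝟙-not+𝟙 false = refl

count-≢₂ : ∀ k (b c : Fin k) → b ≢ c → ∑ᶠ k (λ a → 𝟙 (not (a == b) ∧ not (a == c))) ≡ k ∸ 2
count-≢₂ k b c b≢c = begin
  X                                    ≡⟨ sym (m+n∸n≡m X 2) ⟩
  X + 2 ∸ 2                            ≡⟨ cong (λ y → X + y ∸ 2) (sym (cong₂ _+_ (count-== k b) (count-== k c))) ⟩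
  X + (∑ᶠ k (λ a → 𝟙 (a == b)) + ∑ᶠ k (λ a → 𝟙 (a == c))) ∸ 2
    ≡⟨ cong (λ y → X + y ∸ 2) (sym (∑-+ (allFin k) _ _)) ⟩
  X + ∑ᶠ k (λ a → 𝟙 (a == b) + 𝟙 (a == c)) ∸ 2
    ≡⟨ cong (_∸ 2) (sym (∑-+ (allFin k) _ _)) ⟩
  ∑ᶠ k (λ a → 𝟙 (not (a == b) ∧ not (a == c)) + (𝟙 (a == b) + 𝟙 (a == c))) ∸ 2
    ≡⟨ cong (_∸ 2) (trans (∑-cong (allFin k) partition) (trans (∑ᶠ-const k 1) (*-identityʳ k))) ⟩
  k ∸ 2 ∎
  where
  open ≡-Reasoning
  X = ∑ᶠ k (λ a → 𝟙 (not (a == b) ∧ not (a == c)))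
  exclusive : ∀ x y → (x ≡ true → y ≡ true → ⊥) → 𝟙 (not x ∧ not y) + (𝟙 x + 𝟙 y) ≡ 1
  exclusive true  true  x⇒¬y = ⊥-elim (x⇒¬y refl refl)
  exclusive true  false _    = refl
  exclusive false true  _    = refl
  exclusive false false _    = refl
  partition : ∀ a → 𝟙 (not (a == b) ∧ not (a == c)) + (𝟙 (a == b) + 𝟙 (a == c)) ≡ 1
  partition a = exclusive (a == b) (a == c) (λ a≡b a≡c → b≢c (trans (sym (==⇒≡ a≡b)) (==⇒≡ a≡c)))

Colouring : ℕ → ℕ → Set
Colouring n k = Fin n → Fin k

Extensional : ∀ {n k} → (Colouring n k → ℕ) → Set
Extensional F = ∀ c d → c ≗ d → F c ≡ F d

extensional-* : ∀ {n k} {F G : Colouring n k → ℕ} → Extensional F → Extensional G → Extensional (λ c → F c * G c)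
extensional-* F-ext G-ext c d c≗d = cong₂ _*_ (F-ext c d c≗d) (G-ext c d c≗d)

extend : ∀ {n k} → Fin k → Colouring n k → Colouring (suc n) k
extend a c zero    = a
extend a c (suc i) = c i

∑ᶜ : ∀ n k → (Colouring n k → ℕ) → ℕ
∑ᶜ n k = ∑ (allMaps n k)

∑ᶜ-suc : ∀ n k (F : Colouring (suc n) k → ℕ) → Extensional F →
  ∑ᶜ (suc n) k F ≡ ∑ᶠ k (λ a → ∑ᶜ n k (λ c → F (extend a c)))
∑ᶜ-suc n k F F-ext = trans (∑-concatMap _ (allFin k) F) (∑-cong (allFin k) λ a →
  trans (∑-map _ (allMaps n k) F) (∑-cong (allMaps n k) λ c → F-ext _ _ λ { zero → refl ; (suc i) → refl }))

eqᶜ : ∀ {n k} → Colouring n k → Colouring n k → Bool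
eqᶜ {n} c d = allᶠ n (λ i → c i == d i)

eqᶜ⇒≗ : ∀ {n k} (c d : Colouring n k) → eqᶜ c d ≡ true → c ≗ d
eqᶜ⇒≗ {suc n} c d eq i with c zero == d zero in c₀==d₀
eqᶜ⇒≗ {suc n} c d eq zero    | true = ==⇒≡ c₀==d₀
eqᶜ⇒≗ {suc n} c d eq (suc i) | true = eqᶜ⇒≗ (c ∘ suc) (d ∘ suc) eq i

≗⇒eqᶜ : ∀ {n k} (c d : Colouring n k) → c ≗ d → eqᶜ c d ≡ true
≗⇒eqᶜ {zero}  c d c≗d = refl
≗⇒eqᶜ {suc n} c d c≗d rewrite c≗d zero | ==-refl (d zero) = ≗⇒eqᶜ (c ∘ suc) (d ∘ suc) (c≗d ∘ suc)

eqᶜ-extensional : ∀ {n k} (d : Colouring n k) → Extensional (λ c → 𝟙 (eqᶜ c d))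
eqᶜ-extensional d c c′ c≗c′ = cong 𝟙 (⇔-true⇒≡
  (λ eq → ≗⇒eqᶜ c′ d (λ i → trans (sym (c≗c′ i)) (eqᶜ⇒≗ c d eq i)))
  (λ eq → ≗⇒eqᶜ c d (λ i → trans (c≗c′ i) (eqᶜ⇒≗ c′ d eq i))))

∑ᶜ-δ : ∀ n k (d : Colouring n k) (F : Colouring n k → ℕ) → Extensional F → ∑ᶜ n k (λ c → 𝟙 (eqᶜ c d) * F c) ≡ F d
∑ᶜ-δ zero    k d F F-ext = trans (+-identityʳ _) (trans (+-identityʳ _) (F-ext _ _ λ ()))
∑ᶜ-δ (suc n) k d F F-ext = begin
  ∑ᶜ (suc n) k (λ c → 𝟙 (eqᶜ c d) * F c)
    ≡⟨ ∑ᶜ-suc n k _ (extensional-* (eqᶜ-extensional d) F-ext) ⟩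
  ∑ᶠ k (λ a → ∑ᶜ n k (λ c → 𝟙 ((a == d zero) ∧ eqᶜ c (d ∘ suc)) * F (extend a c)))
    ≡⟨ ∑-cong (allFin k) (λ a → trans (∑-cong (allMaps n k) (λ c → factor a c))
                                      (sym (∑-*ˡ (allMaps n k) (𝟙 (a == d zero)) _))) ⟩
  ∑ᶠ k (λ a → 𝟙 (a == d zero) * ∑ᶜ n k (λ c → 𝟙 (eqᶜ c (d ∘ suc)) * F (extend a c)))
    ≡⟨ ∑ᶠ-δ k (d zero) _ ⟩
  ∑ᶜ n k (λ c → 𝟙 (eqᶜ c (d ∘ suc)) * F (extend (d zero) c))
    ≡⟨ ∑ᶜ-δ n k (d ∘ suc) _ (λ c c′ c≗c′ → F-ext _ _ λ { zero → refl ; (suc i) → c≗c′ i }) ⟩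
  F (extend (d zero) (d ∘ suc))
    ≡⟨ F-ext _ _ (λ { zero → refl ; (suc i) → refl }) ⟩
  F d ∎
  where
  open ≡-Reasoning
  factor : ∀ a c → 𝟙 ((a == d zero) ∧ eqᶜ c (d ∘ suc)) * F (extend a c)
                 ≡ 𝟙 (a == d zero) * (𝟙 (eqᶜ c (d ∘ suc)) * F (extend a c))
  factor a c = trans (cong (_* F (extend a c)) (𝟙-∧ (a == d zero) _)) (*-assoc (𝟙 (a == d zero)) _ _)

count-eqᶜ : ∀ n k (d : Colouring n k) → ∑ᶜ n k (λ c → 𝟙 (eqᶜ c d)) ≡ 1
count-eqᶜ n k d = trans (∑-cong (allMaps n k) (λ c → sym (*-identityʳ (𝟙 (eqᶜ c d))))) (∑ᶜ-δ n k d (λ _ → 1) (λ _ _ _ → refl))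

-- Reindex through the δ-expansion F (Φ c) = ∑ d [d = Φ c] F d and swap the sums.
∑ᶜ-bijection : ∀ n k (Φ Ψ : Colouring n k → Colouring n k) →
  (∀ c d → c ≗ d → Φ c ≗ Φ d) → (∀ c d → c ≗ d → Ψ c ≗ Ψ d) →
  (∀ c → Ψ (Φ c) ≗ c) → (∀ c → Φ (Ψ c) ≗ c) →
  (F : Colouring n k → ℕ) → Extensional F → ∑ᶜ n k (F ∘ Φ) ≡ ∑ᶜ n k F
∑ᶜ-bijection n k Φ Ψ Φ-cong Ψ-cong ΨΦ ΦΨ F F-ext = begin
  ∑ᶜ n k (F ∘ Φ)                                         ≡⟨ ∑-cong (allMaps n k) (λ c → sym (∑ᶜ-δ n k (Φ c) F F-ext)) ⟩
  ∑ᶜ n k (λ c → ∑ᶜ n k (λ d → 𝟙 (eqᶜ d (Φ c)) * F d))  ≡⟨ ∑-comm (allMaps n k) (allMaps n k) _ ⟩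
  ∑ᶜ n k (λ d → ∑ᶜ n k (λ c → 𝟙 (eqᶜ d (Φ c)) * F d))
    ≡⟨ ∑-cong (allMaps n k) (λ d → ∑-cong (allMaps n k) (λ c → cong (λ x → 𝟙 x * F d) (transfer d c))) ⟩
  ∑ᶜ n k (λ d → ∑ᶜ n k (λ c → 𝟙 (eqᶜ c (Ψ d)) * F d))  ≡⟨ ∑-cong (allMaps n k) (λ d → sym (∑-*ʳ (allMaps n k) (F d) _)) ⟩
  ∑ᶜ n k (λ d → ∑ᶜ n k (λ c → 𝟙 (eqᶜ c (Ψ d))) * F d)
    ≡⟨ ∑-cong (allMaps n k) (λ d → trans (cong (_* F d) (count-eqᶜ n k (Ψ d))) (*-identityˡ (F d))) ⟩
  ∑ᶜ n k F ∎
  where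
  open ≡-Reasoning
  transfer : ∀ d c → eqᶜ d (Φ c) ≡ eqᶜ c (Ψ d)
  transfer d c = ⇔-true⇒≡
    (λ eq → ≗⇒eqᶜ c (Ψ d) (λ i → trans (sym (ΨΦ c i)) (Ψ-cong (Φ c) d (λ j → sym (eqᶜ⇒≗ d (Φ c) eq j)) i)))
    (λ eq → ≗⇒eqᶜ d (Φ c) (λ i → trans (sym (ΦΨ d i)) (Φ-cong (Ψ d) c (λ j → sym (eqᶜ⇒≗ c (Ψ d) eq j)) i)))

∑ᶜ-product : ∀ n k (S : Fin n → Fin k → Bool) → ∑ᶜ n k (λ c → ∏ᶠ n (λ i → 𝟙 (S i (c i)))) ≡ ∏ᶠ n (λ i → ∑ᶠ k (𝟙 ∘ S i))
∑ᶜ-product zero    k S = refl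
∑ᶜ-product (suc n) k S = begin
  ∑ᶜ (suc n) k (λ c → ∏ᶠ (suc n) (λ i → 𝟙 (S i (c i))))
    ≡⟨ ∑ᶜ-suc n k _ (λ c d c≗d → ∏ᶠ-cong (suc n) (λ i → cong (𝟙 ∘ S i) (c≗d i))) ⟩
  ∑ᶠ k (λ a → ∑ᶜ n k (λ c → 𝟙 (S zero a) * ∏ᶠ n (λ i → 𝟙 (S (suc i) (c i)))))
    ≡⟨ ∑-cong (allFin k) (λ a → sym (∑-*ˡ (allMaps n k) (𝟙 (S zero a)) _)) ⟩
  ∑ᶠ k (λ a → 𝟙 (S zero a) * ∑ᶜ n k (λ c → ∏ᶠ n (λ i → 𝟙 (S (suc i) (c i)))))
    ≡⟨ sym (∑-*ʳ (allFin k) _ _) ⟩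
  ∑ᶠ k (𝟙 ∘ S zero) * ∑ᶜ n k (λ c → ∏ᶠ n (λ i → 𝟙 (S (suc i) (c i))))
    ≡⟨ cong (∑ᶠ k (𝟙 ∘ S zero) *_) (∑ᶜ-product n k (S ∘ suc)) ⟩
  ∑ᶠ k (𝟙 ∘ S zero) * ∏ᶠ n (λ i → ∑ᶠ k (𝟙 ∘ S (suc i))) ∎
  where open ≡-Reasoning

^-distribʳ-* : ∀ a b d → (a * b) ^ d ≡ a ^ d * b ^ d
^-distribʳ-* a b zero    = refl
^-distribʳ-* a b (suc d) rewrite ^-distribʳ-* a b d =
  solve 4 (λ a b x y → a :* b :* (x :* y) := a :* x :* (b :* y)) refl a b (a ^ d) (b ^ d)

^-congruent : ∀ m c q d → ∃ λ r → (c + m * q) ^ d ≡ c ^ d + m * r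
^-congruent m c q zero    = 0 , cong (1 +_) (sym (*-zeroʳ m))
^-congruent m c q (suc d) =
  let r , eq = ^-congruent m c q d in
  c * r + q * (c ^ d + m * r) , (begin
    (c + m * q) * (c + m * q) ^ d ≡⟨ cong ((c + m * q) *_) eq ⟩
    (c + m * q) * (c ^ d + m * r)  ≡⟨ solve 5 (λ c m q x r → (c :+ m :* q) :* (x :+ m :* r) := c :* x :+ m :* (c :* r :+ q :* (x :+ m :* r))) refl c m q (c ^ d) r ⟩
    c * c ^ d + m * (c * r + q * (c ^ d + m * r)) ∎)
  where open ≡-Reasoning

-- Modulo 3 + s: (2 + s)(1 + s) ≡ 2 and (2 + s)² ≡ 1, so multiplying by (2 + s)^(d + e) turns the term into 2^d.
scaled-term≡2^ : ∀ s d e → ∃ λ r → (2 + s) ^ (d + e) * (suc s ^ d * (2 + s) ^ e) ≡ 2 ^ d + (3 + s) * r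
scaled-term≡2^ s d e =
  let r₁ , eq₁ = ^-congruent (3 + s) 2 s d
      r₂ , eq₂ = ^-congruent (3 + s) 1 (suc s) e
  in r₁ + 2 ^ d * r₂ + (3 + s) * r₁ * r₂ , (begin
    (2 + s) ^ (d + e) * (suc s ^ d * (2 + s) ^ e)
      ≡⟨ cong (_* (suc s ^ d * (2 + s) ^ e)) (^-distribˡ-+-* (2 + s) d e) ⟩
    (2 + s) ^ d * (2 + s) ^ e * (suc s ^ d * (2 + s) ^ e)
      ≡⟨ solve 3 (λ a b c → a :* b :* (c :* b) := (a :* c) :* (b :* b)) refl ((2 + s) ^ d) ((2 + s) ^ e) (suc s ^ d) ⟩
    ((2 + s) ^ d * suc s ^ d) * ((2 + s) ^ e * (2 + s) ^ e)
      ≡⟨ cong₂ _*_ (sym (^-distribʳ-* (2 + s) (suc s) d)) (sym (^-distribʳ-* (2 + s) (2 + s) e)) ⟩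
    ((2 + s) * suc s) ^ d * ((2 + s) * (2 + s)) ^ e
      ≡⟨ cong₂ (λ a b → a ^ d * b ^ e)
           (solve 1 (λ s → (con 2 :+ s) :* (con 1 :+ s) := con 2 :+ (con 3 :+ s) :* s) refl s)
           (solve 1 (λ s → (con 2 :+ s) :* (con 2 :+ s) := con 1 :+ (con 3 :+ s) :* (con 1 :+ s)) refl s) ⟩
    (2 + (3 + s) * s) ^ d * (1 + (3 + s) * suc s) ^ e
      ≡⟨ cong₂ _*_ eq₁ (trans eq₂ (cong (_+ (3 + s) * r₂) (^-zeroˡ e))) ⟩
    (2 ^ d + (3 + s) * r₁) * (1 + (3 + s) * r₂)
      ≡⟨ solve 4 (λ x k r₁ r₂ → (x :+ k :* r₁) :* (con 1 :+ k :* r₂) := x :+ k :* (r₁ :+ x :* r₂ :+ k :* r₁ :* r₂)) refl (2 ^ d) (3 + s) r₁ r₂ ⟩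
    2 ^ d + (3 + s) * (r₁ + 2 ^ d * r₂ + (3 + s) * r₁ * r₂) ∎)
  where open ≡-Reasoning

-- The sum is ≡ ±(1 + s) ≢ 0 modulo 3 + s.
∤-∑-powers : ∀ s N n (d e : Fin n → ℕ) → (∀ v → d v + e v ≡ N) → ∑ᶠ n (λ v → 2 ^ d v) ≡ suc s →
  ¬ (3 + s ∣ ∑ᶠ n (λ v → suc s ^ d v * (2 + s) ^ e v))
∤-∑-powers s N n d e d+e≡N ∑2^d≡1+s 3+s∣X = ≤⇒≯ (∣⇒≤ 3+s∣1+s) (n≤1+n (2 + s))
  where
  r : Fin n → ℕ
  r v = proj₁ (scaled-term≡2^ s (d v) (e v))
  scaled-term : ∀ v → (2 + s) ^ N * (suc s ^ d v * (2 + s) ^ e v) ≡ 2 ^ d v + (3 + s) * r v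
  scaled-term v = subst (λ m → (2 + s) ^ m * (suc s ^ d v * (2 + s) ^ e v) ≡ 2 ^ d v + (3 + s) * r v)
                        (d+e≡N v) (proj₂ (scaled-term≡2^ s (d v) (e v)))
  scaled-sum : (2 + s) ^ N * ∑ᶠ n (λ v → suc s ^ d v * (2 + s) ^ e v) ≡ suc s + (3 + s) * ∑ᶠ n r
  scaled-sum = begin
    (2 + s) ^ N * ∑ᶠ n (λ v → suc s ^ d v * (2 + s) ^ e v)  ≡⟨ ∑-*ˡ (allFin n) ((2 + s) ^ N) _ ⟩
    ∑ᶠ n (λ v → (2 + s) ^ N * (suc s ^ d v * (2 + s) ^ e v)) ≡⟨ ∑-cong (allFin n) scaled-term ⟩
    ∑ᶠ n (λ v → 2 ^ d v + (3 + s) * r v)                     ≡⟨ ∑-+ (allFin n) _ _ ⟩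
    ∑ᶠ n (λ v → 2 ^ d v) + ∑ᶠ n (λ v → (3 + s) * r v)       ≡⟨ cong₂ _+_ ∑2^d≡1+s (sym (∑-*ˡ (allFin n) (3 + s) r)) ⟩
    suc s + (3 + s) * ∑ᶠ n r ∎
    where open ≡-Reasoning
  3+s∣1+s : 3 + s ∣ suc s
  3+s∣1+s = ∣m+n∣m⇒∣n (subst (3 + s ∣_) (trans scaled-sum (+-comm (suc s) _)) (∣n⇒∣m*n ((2 + s) ^ N) 3+s∣X)) (m∣m*n (∑ᶠ n r))

module _ {n : ℕ} where

  elem : Fin n → List (Fin n) → Bool
  elem x []       = false
  elem x (y ∷ ys) = (y == x) ∨ elem x ys

  data Distinct : List (Fin n) → Set where
    []  : Distinct []
    _∷_ : ∀ {x xs} → elem x xs ≡ false → Distinct xs → Distinct (x ∷ xs)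

  last : Fin n → List (Fin n) → Fin n
  last x []       = x
  last _ (y ∷ ys) = last y ys

  last-++ : ∀ x ys y zs → last x (ys ++ y ∷ zs) ≡ last y zs
  last-++ x []       y zs = refl
  last-++ x (w ∷ ys) y zs = last-++ w ys y zs

  Distinct-++⁻ʳ : ∀ xs {ys} → Distinct (xs ++ ys) → Distinct ys
  Distinct-++⁻ʳ []       d       = d
  Distinct-++⁻ʳ (x ∷ xs) (_ ∷ d) = Distinct-++⁻ʳ xs d

  Linked-++⁻ʳ : ∀ {R : Fin n → Fin n → Set} xs {ys} → Linked R (xs ++ ys) → Linked R ys
  Linked-++⁻ʳ []       l = l
  Linked-++⁻ʳ (x ∷ xs) l = Linked-++⁻ʳ xs (Linked.tail l)

  dropUntil : Fin n → List (Fin n) → List (Fin n)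
  dropUntil x []       = []
  dropUntil x (y ∷ ys) = if y == x then y ∷ ys else dropUntil x ys

  split-at : ∀ x ys → elem x ys ≡ true → ∃₂ λ xs zs → ys ≡ xs ++ x ∷ zs × dropUntil x ys ≡ x ∷ zs
  split-at x (y ∷ ys) x∈ys with y == x in y==x
  ... | true rewrite ==⇒≡ y==x = [] , ys , refl , refl
  ... | false with split-at x ys x∈ys
  ...   | xs , zs , ys≡ , drop≡ = y ∷ xs , zs , cong (y ∷_) ys≡ , drop≡

  eraseLoops : List (Fin n) → List (Fin n)
  eraseLoops []       = []
  eraseLoops (x ∷ xs) = if elem x (eraseLoops xs) then dropUntil x (eraseLoops xs) else x ∷ eraseLoops xs

  eraseLoops-head : ∀ x xs → ∃ λ ys → eraseLoops (x ∷ xs) ≡ x ∷ ys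
  eraseLoops-head x xs with elem x (eraseLoops xs) in x∈
  ... | true  = let _ , zs , _ , drop≡ = split-at x (eraseLoops xs) x∈ in zs , drop≡
  ... | false = eraseLoops xs , refl

  eraseLoops-Distinct : ∀ xs → Distinct (eraseLoops xs)
  eraseLoops-Distinct []       = []
  eraseLoops-Distinct (x ∷ xs) with elem x (eraseLoops xs) in x∈
  ... | false = x∈ ∷ eraseLoops-Distinct xs
  ... | true with split-at x (eraseLoops xs) x∈
  ...   | ys , zs , split≡ , drop≡ rewrite drop≡ = Distinct-++⁻ʳ ys (subst Distinct split≡ (eraseLoops-Distinct xs))

  eraseLoops-last : ∀ y xs → last y (eraseLoops xs) ≡ last y xs
  eraseLoops-last y []       = refl
  eraseLoops-last y (x ∷ xs) with elem x (eraseLoops xs) in x∈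
  ... | false = eraseLoops-last x xs
  ... | true with split-at x (eraseLoops xs) x∈
  ...   | ys , zs , split≡ , drop≡ rewrite drop≡ =
    trans (sym (last-++ x ys x zs)) (trans (cong (last x) (sym split≡)) (eraseLoops-last x xs))

  eraseLoops-Linked-∷ : ∀ {R : Fin n → Fin n → Set} x xs → Linked R (x ∷ xs) → Linked R (eraseLoops xs) →
    Linked R (eraseLoops (x ∷ xs))
  eraseLoops-Linked-∷ x xs l ih with elem x (eraseLoops xs) in x∈
  ... | true with split-at x (eraseLoops xs) x∈
  ...   | ys , zs , split≡ , drop≡ rewrite drop≡ = Linked-++⁻ʳ ys (subst (Linked _) split≡ ih)
  eraseLoops-Linked-∷ x []       l         ih | false = [-]
  eraseLoops-Linked-∷ {R} x (y ∷ xs) (xRy ∷ l) ih | false with eraseLoops-head y xs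
  ... | zs , head≡ = subst (λ ws → Linked R (x ∷ ws)) (sym head≡) (xRy ∷ subst (Linked R) head≡ ih)

  eraseLoops-Linked : ∀ {R : Fin n → Fin n → Set} xs → Linked R xs → Linked R (eraseLoops xs)
  eraseLoops-Linked []       l = []
  eraseLoops-Linked (x ∷ xs) l = eraseLoops-Linked-∷ x xs l (eraseLoops-Linked xs (Linked.tail l))

  elem-lookup : ∀ xs i → elem (L.lookup xs i) xs ≡ true
  elem-lookup (x ∷ xs) zero    rewrite ==-refl x = refl
  elem-lookup (x ∷ xs) (suc i) with x == L.lookup xs i
  ... | true  = refl
  ... | false = elem-lookup xs i

  Distinct-lookup-injective : ∀ xs → Distinct xs → ∀ i j → L.lookup xs i ≡ L.lookup xs j → i ≡ j
  Distinct-lookup-injective (x ∷ xs) (x∉ ∷ d) zero    zero    eq = refl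
  Distinct-lookup-injective (x ∷ xs) (x∉ ∷ d) zero    (suc j) eq =
    contradiction (trans (sym (subst (λ y → elem y xs ≡ true) (sym eq) (elem-lookup xs j))) x∉) λ ()
  Distinct-lookup-injective (x ∷ xs) (x∉ ∷ d) (suc i) zero    eq =
    contradiction (trans (sym (subst (λ y → elem y xs ≡ true) eq (elem-lookup xs i))) x∉) λ ()
  Distinct-lookup-injective (x ∷ xs) (x∉ ∷ d) (suc i) (suc j) eq = cong suc (Distinct-lookup-injective xs d i j eq)

  Distinct-length≤ : ∀ xs → Distinct xs → length xs ≤ n
  Distinct-length≤ xs d = ≮⇒≥ λ n<len →
    let i , j , i<j , eq = pigeonhole n<len (L.lookup xs)
    in Fin.<-irrefl (Distinct-lookup-injective xs d i j eq) i<j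

  Linked-lookup : ∀ {R : Fin n → Fin n → Set} x xs → Linked R (x ∷ xs) → ∀ (i : Fin (length xs)) →
    R (L.lookup (x ∷ xs) (inject₁ i)) (L.lookup (x ∷ xs) (suc i))
  Linked-lookup x (y ∷ xs) (xRy ∷ l) zero    = xRy
  Linked-lookup x (y ∷ xs) (xRy ∷ l) (suc i) = Linked-lookup y xs l i

  lookup-last : ∀ x xs → L.lookup (x ∷ xs) (fromℕ (length xs)) ≡ last x xs
  lookup-last x []       = refl
  lookup-last x (y ∷ xs) = lookup-last y xs

  vertices : ∀ {R : Fin n → Fin n → Set} {u w} → Star R u w → List (Fin n)
  vertices ε                 = []
  vertices (_◅_ {j = v} _ p) = v ∷ vertices p

  vertices-Linked : ∀ {R : Fin n → Fin n → Set} {u w} (p : Star R u w) → Linked R (u ∷ vertices p)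
  vertices-Linked ε       = [-]
  vertices-Linked (r ◅ p) = r ∷ vertices-Linked p

  vertices-last : ∀ {R : Fin n → Fin n → Set} {u w} (p : Star R u w) → last u (vertices p) ≡ w
  vertices-last ε       = refl
  vertices-last (_ ◅ p) = vertices-last p

  loopErasedPath : ∀ {R : Fin n → Fin n → Set} {u w} (p : Star R u w) →
    ∃ λ vs → Distinct (u ∷ vs) × Linked R (u ∷ vs) × last u vs ≡ w
  loopErasedPath {R} {u} p =
    let vs , head≡ = eraseLoops-head u (vertices p) in
    vs , subst Distinct head≡ (eraseLoops-Distinct (u ∷ vertices p))
       , subst (Linked R) head≡ (eraseLoops-Linked (u ∷ vertices p) (vertices-Linked p))
       , trans (cong (last u) (sym head≡)) (trans (eraseLoops-last u (u ∷ vertices p)) (vertices-last p))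

Adjacent : ∀ {n} → Graph n → Fin n → Fin n → Set
Adjacent G i j = adj G i j ≡ true

module _ {n : ℕ} (G : Graph n) where

  Adjacent-sym : ∀ {i j} → Adjacent G i j → Adjacent G j i
  Adjacent-sym {i} {j} i~j = trans (Graph.sym G j i) i~j

  Adjacent⇒≢ : ∀ {i j} → Adjacent G i j → i ≢ j
  Adjacent⇒≢ {i} i~i refl = contradiction (trans (sym i~i) (Graph.irrefl G i)) λ ()

  Path : Fin n → Fin n → Set
  Path = Star (Adjacent G)

  Walk⇒Path : ∀ {u w} → Walk G u w → Path u w
  Walk⇒Path here       = ε
  Walk⇒Path (step a p) = a ◅ Walk⇒Path p

  Path⇒Walk : ∀ {u w} → Path u w → Walk G u w
  Path⇒Walk ε       = here
  Path⇒Walk (a ◅ p) = step a (Path⇒Walk p)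

  AdjacencyClosed : (Fin n → Bool) → Set
  AdjacencyClosed R = ∀ i j → Adjacent G i j → R i ≡ R j

  Distinct-closedPath⇒Cycle : ∀ x a b vs → Distinct (x ∷ a ∷ b ∷ vs) → Linked (Adjacent G) (x ∷ a ∷ b ∷ vs) →
    Adjacent G (last x (a ∷ b ∷ vs)) x → Cycle G
  Distinct-closedPath⇒Cycle x a b vs d l closing = record
    { len   = length vs
    ; vert  = L.lookup (x ∷ a ∷ b ∷ vs)
    ; inj   = Distinct-lookup-injective (x ∷ a ∷ b ∷ vs) d _ _
    ; cons  = Linked-lookup x (a ∷ b ∷ vs) l
    ; close = subst (λ y → Adjacent G y x) (sym (lookup-last x (a ∷ b ∷ vs))) closing
    }

  cycle-neighbours : (cyc : Cycle G) → ∀ i → ∃₂ λ p q →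
    Adjacent G (Cycle.vert cyc i) (Cycle.vert cyc p) × Adjacent G (Cycle.vert cyc i) (Cycle.vert cyc q) × p ≢ q
  cycle-neighbours cyc zero = suc zero , fromℕ _ , cons zero , Adjacent-sym close , λ ()
    where open Cycle cyc
  cycle-neighbours cyc (suc i) with view i
  ... | ‵fromℕ = inject₁ (fromℕ _) , zero , Adjacent-sym (cons (fromℕ _)) , close , λ ()
    where open Cycle cyc
  ... | ‵inject₁ j = inject₁ (inject₁ j) , suc (suc j) , Adjacent-sym (cons (inject₁ j)) , cons (suc j) , inject₁²≢suc²
    where
    open Cycle cyc
    inject₁²≢suc² : inject₁ (inject₁ j) ≢ suc (suc j)
    inject₁²≢suc² eq = <⇒≢ (m<n+m (toℕ j) {2} (s≤s z≤n))
      (trans (sym (trans (toℕ-inject₁ (inject₁ j)) (toℕ-inject₁ j))) (cong toℕ eq))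

argmax : ∀ m (f : Fin (suc m) → ℕ) → ∃ λ i → ∀ j → f j ≤ f i
argmax zero    f = zero , λ { zero → ≤-refl }
argmax (suc m) f with argmax m (f ∘ suc)
... | i , maximal with f zero ≤? f (suc i)
...   | yes f₀≤ = suc i , λ { zero → f₀≤ ; (suc j) → maximal j }
...   | no  f₀≰ = zero  , λ { zero → ≤-refl ; (suc j) → ≤-trans (maximal j) (<⇒≤ (≰⇒> f₀≰)) }

anyᶠ : (n : ℕ) → (Fin n → Bool) → Bool
anyᶠ zero    p = false
anyᶠ (suc n) p = p zero ∨ anyᶠ n (p ∘ suc)

anyᶠ-sound : ∀ n (p : Fin n → Bool) → anyᶠ n p ≡ true → ∃ λ i → p i ≡ true
anyᶠ-sound (suc n) p any with p zero in p₀
... | true  = zero , p₀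
... | false = let i , pᵢ = anyᶠ-sound n (p ∘ suc) any in suc i , pᵢ

anyᶠ-complete : ∀ n (p : Fin n → Bool) i → p i ≡ true → anyᶠ n p ≡ true
anyᶠ-complete (suc n) p zero    pᵢ rewrite pᵢ = refl
anyᶠ-complete (suc n) p (suc i) pᵢ with p zero
... | true  = refl
... | false = anyᶠ-complete n (p ∘ suc) i pᵢ

choose : ∀ {n} → (Fin n → Bool) → Fin n → Fin n
choose p default with any? (λ i → p i Bool.≟ true)
... | yes (i , _) = i
... | no  _       = default

choose-sound : ∀ {n} (p : Fin n → Bool) default i → p i ≡ true → p (choose p default) ≡ true
choose-sound p default i pᵢ with any? (λ i → p i Bool.≟ true)
... | yes (_ , pⱼ) = pⱼ
... | no  none     = ⊥-elim (none (i , pᵢ))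

least : (ℕ → Bool) → ℕ → ℕ
least p zero    = zero
least p (suc N) = if p (least p N) then least p N else suc N

least-≤ : ∀ (p : ℕ → Bool) N → least p N ≤ N
least-≤ p zero    = z≤n
least-≤ p (suc N) with p (least p N)
... | true  = m≤n⇒m≤1+n (least-≤ p N)
... | false = ≤-refl

least-sound : ∀ (p : ℕ → Bool) N t → p t ≡ true → t ≤ N → p (least p N) ≡ true
least-sound p zero    zero    pₜ _   = pₜ
least-sound p (suc N) t       pₜ t≤N with p (least p N) in pₗ
... | true  = pₗ
... | false with m≤n⇒m<n∨m≡n t≤N
...   | inj₁ t<1+N = contradiction (trans (sym (least-sound p N t pₜ (≤-pred t<1+N))) pₗ) λ ()
...   | inj₂ refl  = pₜ

least-minimal : ∀ (p : ℕ → Bool) N t → p t ≡ true → t ≤ N → least p N ≤ t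
least-minimal p zero    zero    pₜ _   = z≤n
least-minimal p (suc N) t       pₜ t≤N with p (least p N) in pₗ | m≤n⇒m<n∨m≡n t≤N
... | true  | inj₁ t<1+N = least-minimal p N t pₜ (≤-pred t<1+N)
... | true  | inj₂ refl  = m≤n⇒m≤1+n (least-≤ p N)
... | false | inj₁ t<1+N = contradiction (trans (sym (least-sound p N t pₜ (≤-pred t<1+N))) pₗ) λ ()
... | false | inj₂ refl  = ≤-refl

module Reachability {n : ℕ} (G : Graph n) where

  reachesWithin : ℕ → Fin n → Fin n → Bool
  reachesWithin zero    u w = u == w
  reachesWithin (suc t) u w = (u == w) ∨ anyᶠ n (λ v → adj G u v ∧ reachesWithin t v w)

  reachesWithin-refl : ∀ t u → reachesWithin t u u ≡ true
  reachesWithin-refl zero    u = ==-refl u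
  reachesWithin-refl (suc t) u rewrite ==-refl u = refl

  reachesWithin-step : ∀ t {u v w} → Adjacent G u v → reachesWithin t v w ≡ true → reachesWithin (suc t) u w ≡ true
  reachesWithin-step t {u} {v} {w} u~v v⇝w with u == w
  ... | true  = refl
  ... | false = anyᶠ-complete n _ v (cong₂ _∧_ u~v v⇝w)

  reachesWithin-next : ∀ t {u w} → reachesWithin (suc t) u w ≡ true → u ≢ w →
    ∃ λ v → Adjacent G u v × reachesWithin t v w ≡ true
  reachesWithin-next t {u} {w} u⇝w u≢w rewrite ≢⇒==false u≢w =
    let v , eq = anyᶠ-sound n _ u⇝w in v , ∧-true⁻ eq

  reachesWithin⇒Path : ∀ t {u w} → reachesWithin t u w ≡ true → Path G u w
  reachesWithin⇒Path zero    u⇝w rewrite ==⇒≡ u⇝w = ε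
  reachesWithin⇒Path (suc t) {u} {w} u⇝w = ≟-elim u w (λ { refl → ε }) λ u≢w →
    let v , u~v , v⇝w = reachesWithin-next t u⇝w u≢w in u~v ◅ reachesWithin⇒Path t v⇝w

  reachesWithin-suc : ∀ t {u w} → reachesWithin t u w ≡ true → reachesWithin (suc t) u w ≡ true
  reachesWithin-suc zero    {u} {w} u⇝w rewrite u⇝w = refl
  reachesWithin-suc (suc t) {u} {w} u⇝w = ≟-elim u w (λ { refl → reachesWithin-refl (2 + t) u }) λ u≢w →
    let v , u~v , v⇝w = reachesWithin-next t u⇝w u≢w in reachesWithin-step (suc t) u~v (reachesWithin-suc t v⇝w)

  reachesWithin-mono : ∀ {s t u w} → s ≤ t → reachesWithin s u w ≡ true → reachesWithin t u w ≡ true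
  reachesWithin-mono {s} {u = u} {w} s≤t u⇝w = go (≤⇒≤′ s≤t)
    where
    go : ∀ {t} → s ≤′ t → reachesWithin t u w ≡ true
    go ≤′-refl        = u⇝w
    go {suc t} (≤′-step s≤′t) = reachesWithin-suc t (go s≤′t)

  Linked⇒reachesWithin : ∀ u vs {w} → Linked (Adjacent G) (u ∷ vs) → last u vs ≡ w → reachesWithin (length vs) u w ≡ true
  Linked⇒reachesWithin u []       [-]        refl = reachesWithin-refl 0 u
  Linked⇒reachesWithin u (v ∷ vs) (u~v ∷ l) last≡ = reachesWithin-step (length vs) u~v (Linked⇒reachesWithin v vs l last≡)

  reaches : Fin n → Fin n → Bool
  reaches = reachesWithin n

  -- Loop erasure bounds the length of a connecting path by the number of vertices.
  Path⇒reaches : ∀ {u w} → Path G u w → reaches u w ≡ true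
  Path⇒reaches {u} p =
    let vs , distinct , linked , last≡ = loopErasedPath p
    in reachesWithin-mono (<⇒≤ (Distinct-length≤ (u ∷ vs) distinct)) (Linked⇒reachesWithin u vs linked last≡)

  reaches⇒Path : ∀ {u w} → reaches u w ≡ true → Path G u w
  reaches⇒Path = reachesWithin⇒Path n

  reaches-AdjacencyClosed : ∀ i → AdjacencyClosed G (reaches i)
  reaches-AdjacencyClosed i a b a~b = ⇔-true⇒≡
    (λ i⇝a → Path⇒reaches (reaches⇒Path i⇝a ◅◅ (a~b ◅ ε)))
    (λ i⇝b → Path⇒reaches (reaches⇒Path i⇝b ◅◅ (Adjacent-sym G a~b ◅ ε)))

record SpanningTree {n} (G : Graph n) (r : Fin n) : Set where
  field
    parent      : Fin n → Fin n
    rank        : Fin n → ℕ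
    rank-≤      : ∀ u → rank u ≤ n
    parent-adj  : ∀ u → u ≢ r → Adjacent G u (parent u)
    parent-rank : ∀ u → u ≢ r → rank (parent u) < rank u
    parent-root : ∀ u → Adjacent G u r → parent u ≡ r

module BFS {n : ℕ} (G : Graph n) (connected : Connected G) (r : Fin n) where
  open Reachability G

  dist : Fin n → ℕ
  dist u = least (λ t → reachesWithin t u r) n

  dist-sound : ∀ u → reachesWithin (dist u) u r ≡ true
  dist-sound u = least-sound (λ t → reachesWithin t u r) n n (Path⇒reaches (Walk⇒Path G (connected u r))) ≤-refl

  dist-minimal : ∀ u t → reachesWithin t u r ≡ true → t ≤ n → dist u ≤ t
  dist-minimal u = least-minimal (λ t → reachesWithin t u r) n

  dist-suc : ∀ u → u ≢ r → dist u ≡ suc (pred (dist u))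
  dist-suc u u≢r with dist u | dist-sound u
  ... | zero  | u==r = ⊥-elim (u≢r (==⇒≡ u==r))
  ... | suc _ | _    = refl

  isParent : Fin n → Fin n → Bool
  isParent u v = adj G u v ∧ reachesWithin (pred (dist u)) v r

  parent : Fin n → Fin n
  parent u = choose (isParent u) r

  parent-isParent : ∀ u → u ≢ r → isParent u (parent u) ≡ true
  parent-isParent u u≢r =
    let v , u~v , v⇝r = reachesWithin-next (pred (dist u)) (subst (λ t → reachesWithin t u r ≡ true) (dist-suc u u≢r) (dist-sound u)) u≢r
    in choose-sound (isParent u) r v (cong₂ _∧_ u~v v⇝r)

  parent-adj : ∀ u → u ≢ r → Adjacent G u (parent u)
  parent-adj u u≢r = proj₁ (∧-true⁻ (parent-isParent u u≢r))

  parent-reaches : ∀ u → u ≢ r → reachesWithin (pred (dist u)) (parent u) r ≡ true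
  parent-reaches u u≢r = proj₂ (∧-true⁻ {adj G u (parent u)} (parent-isParent u u≢r))

  parent-rank : ∀ u → u ≢ r → dist (parent u) < dist u
  parent-rank u u≢r = subst (dist (parent u) <_) (sym (dist-suc u u≢r))
    (s≤s (dist-minimal (parent u) (pred (dist u)) (parent-reaches u u≢r) (≤-trans pred[n]≤n (least-≤ (λ t → reachesWithin t u r) n))))

  parent-root : ∀ u → Adjacent G u r → parent u ≡ r
  parent-root u u~r = ==⇒≡ (subst (λ t → reachesWithin t (parent u) r ≡ true) pred-dist≡0 (parent-reaches u u≢r))
    where
    u≢r = Adjacent⇒≢ G u~r
    dist≤1 : dist u ≤ 1
    dist≤1 = dist-minimal u 1 (reachesWithin-step 0 u~r (reachesWithin-refl 0 r)) (≤-trans (s≤s z≤n) (toℕ<n u))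
    pred-dist≡0 : pred (dist u) ≡ 0
    pred-dist≡0 = n≤0⇒n≡0 (≤-pred (subst (_≤ 1) (dist-suc u u≢r) dist≤1))

  bfsTree : SpanningTree G r
  bfsTree = record
    { parent = parent ; rank = dist ; rank-≤ = λ u → least-≤ (λ t → reachesWithin t u r) n
    ; parent-adj = parent-adj ; parent-rank = parent-rank ; parent-root = parent-root }

module TreeEdges {n : ℕ} {G : Graph n} {r : Fin n} (T : SpanningTree G r) where
  open SpanningTree T

  TreeEdge : Fin n → Fin n → Set
  TreeEdge a b = (a ≢ r × parent a ≡ b) ⊎ (b ≢ r × parent b ≡ a)

  TreeEdge? : ∀ a b → Dec (TreeEdge a b)
  TreeEdge? a b = (¬? (a ≟ r) ×-dec (parent a ≟ b)) ⊎-dec (¬? (b ≟ r) ×-dec (parent b ≟ a))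

  TreeEdge-sym : ∀ {a b} → TreeEdge a b → TreeEdge b a
  TreeEdge-sym = Sum.swap

  TreeEdge⇒Adjacent : ∀ {a b} → TreeEdge a b → Adjacent G a b
  TreeEdge⇒Adjacent (inj₁ (a≢r , refl)) = parent-adj _ a≢r
  TreeEdge⇒Adjacent (inj₂ (b≢r , refl)) = Adjacent-sym G (parent-adj _ b≢r)

  pathToRoot : ∀ u → Star TreeEdge u r
  pathToRoot u = go (suc n) u (s≤s (rank-≤ u))
    where
    go : ∀ fuel u → rank u < fuel → Star TreeEdge u r
    go (suc fuel) u (s≤s rank≤) = ≟-elim u r (λ { refl → ε }) λ u≢r →
      inj₁ (u≢r , refl) ◅ go fuel (parent u) (≤-trans (parent-rank u u≢r) rank≤)

  -- The tree path from x to y, closed up by the edge y x.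
  nonTreeEdge⇒Cycle : ∀ {x y} → Adjacent G x y → ¬ TreeEdge x y → Cycle G
  nonTreeEdge⇒Cycle {x} {y} x~y x≁y with loopErasedPath (pathToRoot x ◅◅ reverse TreeEdge-sym (pathToRoot y))
  ... | []          , _        , _          , refl = ⊥-elim (Adjacent⇒≢ G x~y refl)
  ... | a ∷ []      , _        , (x≈a ∷ _) , refl = ⊥-elim (x≁y x≈a)
  ... | a ∷ b ∷ vs , distinct , linked     , last≡ =
    Distinct-closedPath⇒Cycle G x a b vs distinct (Linked.map TreeEdge⇒Adjacent linked)
      (subst (λ z → Adjacent G z x) (sym last≡) (Adjacent-sym G x~y))

  acyclic⇒TreeEdge : Acyclic G → ∀ {x y} → Adjacent G x y → TreeEdge x y
  acyclic⇒TreeEdge acyclic {x} {y} x~y with TreeEdge? x y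
  ... | yes x≈y = x≈y
  ... | no  x≁y = ⊥-elim (acyclic (nonTreeEdge⇒Cycle x~y x≁y))

  rank-maximal⇒¬TreeEdge : ∀ {x y} → rank y ≤ rank x → parent x ≢ y → ¬ TreeEdge x y
  rank-maximal⇒¬TreeEdge rank≤ parent≢y (inj₁ (_ , parent≡y))   = parent≢y parent≡y
  rank-maximal⇒¬TreeEdge {x} {y} rank≤ parent≢y (inj₂ (y≢r , parent≡x)) =
    <⇒≱ (subst (λ z → rank z < rank y) parent≡x (parent-rank y y≢r)) rank≤

  -- A vertex of maximal rank on the cycle has two cycle neighbours, at most one of which is its parent.
  cycle⇒nonTreeEdge : Cycle G → ∃₂ λ x y → Adjacent G x y × ¬ TreeEdge x y
  cycle⇒nonTreeEdge cyc with argmax _ (rank ∘ Cycle.vert cyc)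
  ... | i , maximal with cycle-neighbours G cyc i
  ...   | p , q , i~p , i~q , p≢q = ≟-elim (parent (vert i)) (vert p)
    (λ parent≡p → vert i , vert q , i~q , rank-maximal⇒¬TreeEdge (maximal q) λ parent≡q → p≢q (inj (trans (sym parent≡p) parent≡q)))
    (λ parent≢p → vert i , vert p , i~p , rank-maximal⇒¬TreeEdge (maximal p) parent≢p)
    where open Cycle cyc

allᶠ-sound : ∀ n (p : Fin n → Bool) → allᶠ n p ≡ true → ∀ i → p i ≡ true
allᶠ-sound (suc n) p all zero    = proj₁ (∧-true⁻ all)
allᶠ-sound (suc n) p all (suc i) = allᶠ-sound n (p ∘ suc) (proj₂ (∧-true⁻ {p zero} all)) i

allᶠ-complete : ∀ n (p : Fin n → Bool) → (∀ i → p i ≡ true) → allᶠ n p ≡ true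
allᶠ-complete zero    p all = refl
allᶠ-complete (suc n) p all = cong₂ _∧_ (all zero) (allᶠ-complete n (p ∘ suc) (all ∘ suc))

allᶠ-cong : ∀ n {p q : Fin n → Bool} → (∀ i → p i ≡ q i) → allᶠ n p ≡ allᶠ n q
allᶠ-cong zero    p≗q = refl
allᶠ-cong (suc n) p≗q = cong₂ _∧_ (p≗q zero) (allᶠ-cong n (p≗q ∘ suc))

allᶠ-false : ∀ n (p : Fin n → Bool) i → p i ≡ false → allᶠ n p ≡ false
allᶠ-false n p i pᵢ with allᶠ n p in all
... | false = refl
... | true  = contradiction (trans (sym (allᶠ-sound n p all i)) pᵢ) λ ()

and≡allᶠ : ∀ n (p : Fin n → Bool) → and (map p (allFin n)) ≡ allᶠ n p
and≡allᶠ zero    p = refl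
and≡allᶠ (suc n) p = cong (p zero ∧_) (trans (cong and (trans (LP.map-tabulate suc p) (sym (LP.map-tabulate id (p ∘ suc)))))
                                             (and≡allᶠ n (p ∘ suc)))

module _ {n k : ℕ} (G : Graph n) where

  Proper : Colouring n k → Set
  Proper c = ∀ i j → Adjacent G i j → c i ≢ c j

  isProper≡allᶠ : ∀ (c : Colouring n k) → isProper G c ≡ allᶠ n (λ i → allᶠ n (λ j → not (adj G i j) ∨ not (c i == c j)))
  isProper≡allᶠ c = trans (and≡allᶠ n _) (allᶠ-cong n (λ i → and≡allᶠ n _))

  isProper-sound : ∀ c → isProper G c ≡ true → Proper c
  isProper-sound c proper i j i~j cᵢ≡cⱼ = contradiction
    (trans (sym (allᶠ-sound n _ (allᶠ-sound n _ (trans (sym (isProper≡allᶠ c)) proper) i) j))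
           (cong₂ (λ a b → not a ∨ not b) i~j (trans (cong (_== c j) cᵢ≡cⱼ) (==-refl (c j))))) λ ()

  isProper-complete : ∀ c → Proper c → isProper G c ≡ true
  isProper-complete c proper = trans (isProper≡allᶠ c) (allᶠ-complete n _ λ i → allᶠ-complete n _ λ j → edgeOk i j)
    where
    edgeOk : ∀ i j → not (adj G i j) ∨ not (c i == c j) ≡ true
    edgeOk i j with adj G i j in i~j
    ... | false = refl
    ... | true rewrite ≢⇒==false (proper i j i~j) = refl

  Proper-resp-≗ : ∀ {c d} → c ≗ d → Proper c → Proper d
  Proper-resp-≗ c≗d proper i j i~j dᵢ≡dⱼ = proper i j i~j (trans (c≗d i) (trans dᵢ≡dⱼ (sym (c≗d j))))

  isProper-cong : ∀ {c d : Colouring n k} → c ≗ d → isProper G c ≡ isProper G d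
  isProper-cong {c} {d} c≗d = ⇔-true⇒≡
    (λ p → isProper-complete d (Proper-resp-≗ c≗d (isProper-sound c p)))
    (λ p → isProper-complete c (Proper-resp-≗ (sym ∘ c≗d) (isProper-sound d p)))

_[_↦_] : ∀ {n k} → Colouring n k → Fin n → Fin k → Colouring n k
(c [ v ↦ b ]) w = if w == v then b else c w

[↦]-at : ∀ {n k} (c : Colouring n k) v b → (c [ v ↦ b ]) v ≡ b
[↦]-at c v b rewrite ==-refl v = refl

[↦]-elsewhere : ∀ {n k} (c : Colouring n k) {v} b {w} → w ≢ v → (c [ v ↦ b ]) w ≡ c w
[↦]-elsewhere c b w≢v rewrite ≢⇒==false w≢v = refl

[↦]-cong : ∀ {n k} {c d : Colouring n k} v b → c ≗ d → c [ v ↦ b ] ≗ d [ v ↦ b ]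
[↦]-cong v b c≗d w with w == v
... | true  = refl
... | false = c≗d w

isFlip : ∀ {n k} → Graph n → Fin n → Fin k → Fin k → Colouring n k → Bool
isFlip G v a b c = isProper G c ∧ (c v == a) ∧ isProper G (c [ v ↦ b ])

isFlip-extensional : ∀ {n k} (G : Graph n) v (a b : Fin k) → Extensional (𝟙 ∘ isFlip G v a b)
isFlip-extensional G v a b c d c≗d =
  cong 𝟙 (cong₂ _∧_ (isProper-cong G c≗d) (cong₂ _∧_ (cong (_== a) (c≗d v)) (isProper-cong G ([↦]-cong v b c≗d))))

-- The number of edges c — c[v ↦ b] of 𝒞ₖ(G) with c v = a.
flips : ∀ {n} → Graph n → ∀ k → Fin n → Fin k → Fin k → ℕ
flips {n} G k v a b = ∑ᶜ n k (𝟙 ∘ isFlip G v a b)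

isZero : ℕ → Bool
isZero zero    = true
isZero (suc _) = false

allᶠ-not≡isZero : ∀ n (p : Fin n → Bool) → allᶠ n (not ∘ p) ≡ isZero (∑ᶠ n (𝟙 ∘ p))
allᶠ-not≡isZero zero    p = refl
allᶠ-not≡isZero (suc n) p rewrite ∑ᶠ-suc n (𝟙 ∘ p) with p zero
... | true  = refl
... | false = allᶠ-not≡isZero n (p ∘ suc)

isOne-suc : ∀ x → isOne (suc x) ≡ isZero x
isOne-suc zero    = refl
isOne-suc (suc x) = refl

isOne≡∑ : ∀ n (p : Fin n → Bool) → 𝟙 (isOne (∑ᶠ n (𝟙 ∘ p))) ≡ ∑ᶠ n (λ v → 𝟙 (p v) * 𝟙 (allᶠ n (λ w → (w == v) ∨ not (p w))))
isOne≡∑ zero    p = refl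
isOne≡∑ (suc n) p rewrite ∑ᶠ-suc n (𝟙 ∘ p) | ∑ᶠ-suc n (λ v → 𝟙 (p v) * 𝟙 (allᶠ (suc n) (λ w → (w == v) ∨ not (p w))))
                        | ==-refl {suc n} zero with p zero
... | true  = trans (cong 𝟙 (trans (isOne-suc _) (sym (allᶠ-not≡isZero n (p ∘ suc))))) (sym (trans
  (cong₂ _+_ (+-identityʳ _) (trans (∑-cong (allFin n) (λ v → *-zeroʳ (𝟙 (p (suc v))))) (∑-zero (allFin n)))) (+-identityʳ _)))
... | false = trans (isOne≡∑ n (p ∘ suc)) (∑-cong (allFin n) λ v →
  cong (λ x → 𝟙 (p (suc v)) * 𝟙 x) (allᶠ-cong n (λ w → cong (_∨ not (p (suc w))) (sym (suc-== w v)))))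

module _ {n k : ℕ} where

  agreeOff : Colouring n k → Colouring n k → Fin n → Bool
  agreeOff c d v = allᶠ n (λ w → (w == v) ∨ not (not (c w == d w)))

  eqᶜ-[↦] : ∀ (c d : Colouring n k) v b → eqᶜ d (c [ v ↦ b ]) ≡ (b == d v) ∧ agreeOff c d v
  eqᶜ-[↦] c d v b = ⇔-true⇒≡ ⇒ ⇐
    where
    ⇒ : eqᶜ d (c [ v ↦ b ]) ≡ true → (b == d v) ∧ agreeOff c d v ≡ true
    ⇒ eq = cong₂ _∧_ (trans (cong (_== d v) (trans (sym ([↦]-at c v b)) (sym (d≗ v)))) (==-refl (d v))) (allᶠ-complete n _ agree)
      where
      d≗ = eqᶜ⇒≗ d (c [ v ↦ b ]) eq
      agree : ∀ w → (w == v) ∨ not (not (c w == d w)) ≡ true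
      agree w = ≟-elim w v (λ { refl → cong (_∨ _) (==-refl w) }) λ w≢v →
        trans (cong₂ _∨_ (≢⇒==false w≢v) (not-involutive (c w == d w)))
              (trans (cong (c w ==_) (trans (d≗ w) ([↦]-elsewhere c b w≢v))) (==-refl (c w)))
    ⇐ : (b == d v) ∧ agreeOff c d v ≡ true → eqᶜ d (c [ v ↦ b ]) ≡ true
    ⇐ eq = ≗⇒eqᶜ d (c [ v ↦ b ]) λ w → ≟-elim w v
      (λ { refl → trans (sym (==⇒≡ b==dv)) (sym ([↦]-at c w b)) })
      (λ w≢v → trans (sym (==⇒≡ (c==d w w≢v))) (sym ([↦]-elsewhere c b w≢v)))
      where
      b==dv = proj₁ (∧-true⁻ eq)
      c==d : ∀ w → w ≢ v → (c w == d w) ≡ true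
      c==d w w≢v with ∨-true⁻ (allᶠ-sound n _ (proj₂ (∧-true⁻ {b == d v} eq)) w)
      ... | inj₁ w==v = ⊥-elim (w≢v (==⇒≡ w==v))
      ... | inj₂ ok   = trans (sym (not-involutive (c w == d w))) ok

  -- d differs from c in exactly one vertex iff d = c[v ↦ b] for exactly one pair (v , b) with b ≠ c v.
  isOne-diffCount : ∀ (c d : Colouring n k) →
    𝟙 (isOne (diffCount c d)) ≡ ∑ᶠ n (λ v → ∑ᶠ k (λ b → 𝟙 (not (c v == b)) * 𝟙 (eqᶜ d (c [ v ↦ b ]))))
  isOne-diffCount c d = begin
    𝟙 (isOne (diffCount c d))
      ≡⟨ cong (𝟙 ∘ isOne) (length-filterᵇ _ (allFin n)) ⟩
    𝟙 (isOne (∑ᶠ n (λ v → 𝟙 (not (c v == d v)))))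
      ≡⟨ isOne≡∑ n (λ v → not (c v == d v)) ⟩
    ∑ᶠ n (λ v → 𝟙 (not (c v == d v)) * 𝟙 (agreeOff c d v))
      ≡⟨ ∑-cong (allFin n) (λ v → sym (∑ᶠ-δ k (d v) (λ b → 𝟙 (not (c v == b)) * 𝟙 (agreeOff c d v)))) ⟩
    ∑ᶠ n (λ v → ∑ᶠ k (λ b → 𝟙 (b == d v) * (𝟙 (not (c v == b)) * 𝟙 (agreeOff c d v))))
      ≡⟨ ∑-cong (allFin n) (λ v → ∑-cong (allFin k) λ b → trans
           (solve 3 (λ x y z → x :* (y :* z) := y :* (x :* z)) refl (𝟙 (b == d v)) (𝟙 (not (c v == b))) (𝟙 (agreeOff c d v)))
           (cong (𝟙 (not (c v == b)) *_) (trans (sym (𝟙-∧ (b == d v) _)) (cong 𝟙 (sym (eqᶜ-[↦] c d v b)))))) ⟩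
    ∑ᶠ n (λ v → ∑ᶠ k (λ b → 𝟙 (not (c v == b)) * 𝟙 (eqᶜ d (c [ v ↦ b ])))) ∎
    where open ≡-Reasoning

  ∑-adjacent : ∀ (c : Colouring n k) (F : Colouring n k → ℕ) → Extensional F →
    ∑ᶜ n k (λ d → F d * 𝟙 (isOne (diffCount c d))) ≡ ∑ᶠ n (λ v → ∑ᶠ k (λ b → 𝟙 (not (c v == b)) * F (c [ v ↦ b ])))
  ∑-adjacent c F F-ext = begin
    ∑ᶜ n k (λ d → F d * 𝟙 (isOne (diffCount c d)))
      ≡⟨ ∑-cong (allMaps n k) (λ d → trans (cong (F d *_) (isOne-diffCount c d))
           (trans (∑-*ˡ (allFin n) (F d) _) (∑-cong (allFin n) (λ v → ∑-*ˡ (allFin k) (F d) _)))) ⟩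
    ∑ᶜ n k (λ d → ∑ᶠ n (λ v → ∑ᶠ k (λ b → F d * (𝟙 (not (c v == b)) * 𝟙 (eqᶜ d (c [ v ↦ b ]))))))
      ≡⟨ trans (∑-comm (allMaps n k) (allFin n) _) (∑-cong (allFin n) (λ v → ∑-comm (allMaps n k) (allFin k) _)) ⟩
    ∑ᶠ n (λ v → ∑ᶠ k (λ b → ∑ᶜ n k (λ d → F d * (𝟙 (not (c v == b)) * 𝟙 (eqᶜ d (c [ v ↦ b ]))))))
      ≡⟨ ∑-cong (allFin n) (λ v → ∑-cong (allFin k) λ b → trans (∑-cong (allMaps n k) (λ d →
           solve 3 (λ x y z → x :* (y :* z) := z :* (y :* x)) refl (F d) (𝟙 (not (c v == b))) (𝟙 (eqᶜ d (c [ v ↦ b ])))))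
           (∑ᶜ-δ n k (c [ v ↦ b ]) (λ d → 𝟙 (not (c v == b)) * F d) (λ d d′ d≗d′ → cong (𝟙 (not (c v == b)) *_) (F-ext d d′ d≗d′)))) ⟩
    ∑ᶠ n (λ v → ∑ᶠ k (λ b → 𝟙 (not (c v == b)) * F (c [ v ↦ b ]))) ∎
    where open ≡-Reasoning

module _ {n : ℕ} (G : Graph n) (k : ℕ) where

  ∑-flips : ∀ v b → ∑ᶜ n k (λ c → 𝟙 (isProper G c) * (𝟙 (not (c v == b)) * 𝟙 (isProper G (c [ v ↦ b ]))))
                  ≡ ∑ᶠ k (λ a → 𝟙 (not (a == b)) * flips G k v a b)
  ∑-flips v b = begin
    ∑ᶜ n k (λ c → P c * (𝟙 (not (c v == b)) * Q c))
      ≡⟨ ∑-cong (allMaps n k) (λ c → sym (trans (∑-cong (allFin k) (λ a → rearrange c a)) (∑ᶠ-δ k (c v) (λ a → P c * (𝟙 (not (a == b)) * Q c))))) ⟩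
    ∑ᶜ n k (λ c → ∑ᶠ k (λ a → 𝟙 (not (a == b)) * 𝟙 (isFlip G v a b c)))
      ≡⟨ ∑-comm (allMaps n k) (allFin k) _ ⟩
    ∑ᶠ k (λ a → ∑ᶜ n k (λ c → 𝟙 (not (a == b)) * 𝟙 (isFlip G v a b c)))
      ≡⟨ ∑-cong (allFin k) (λ a → sym (∑-*ˡ (allMaps n k) (𝟙 (not (a == b))) _)) ⟩
    ∑ᶠ k (λ a → 𝟙 (not (a == b)) * flips G k v a b) ∎
    where
    open ≡-Reasoning
    P Q : Colouring n k → ℕ
    P c = 𝟙 (isProper G c)
    Q c = 𝟙 (isProper G (c [ v ↦ b ]))
    rearrange : ∀ c a → 𝟙 (not (a == b)) * 𝟙 (isFlip G v a b c) ≡ 𝟙 (a == c v) * (P c * (𝟙 (not (a == b)) * Q c))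
    rearrange c a = begin
      𝟙 (not (a == b)) * 𝟙 (isFlip G v a b c)
        ≡⟨ cong (𝟙 (not (a == b)) *_) (trans (𝟙-∧ (isProper G c) _) (cong (P c *_) (𝟙-∧ (c v == a) _))) ⟩
      𝟙 (not (a == b)) * (P c * (𝟙 (c v == a) * Q c))
        ≡⟨ solve 4 (λ x p y q → x :* (p :* (y :* q)) := y :* (p :* (x :* q))) refl (𝟙 (not (a == b))) (P c) (𝟙 (c v == a)) (Q c) ⟩
      𝟙 (c v == a) * (P c * (𝟙 (not (a == b)) * Q c))
        ≡⟨ cong (λ x → 𝟙 x * (P c * (𝟙 (not (a == b)) * Q c))) (==-sym (c v) a) ⟩
      𝟙 (a == c v) * (P c * (𝟙 (not (a == b)) * Q c)) ∎

  orderedAdjPairs≡∑flips : orderedAdjPairs G k ≡ ∑ᶠ n (λ v → ∑ᶠ k (λ b → ∑ᶠ k (λ a → 𝟙 (not (a == b)) * flips G k v a b)))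
  orderedAdjPairs≡∑flips = begin
    orderedAdjPairs G k
      ≡⟨ length-concatMap _ (properColorings G k) ⟩
    ∑ (properColorings G k) (λ c → length (filterᵇ (λ d → isOne (diffCount c d)) (properColorings G k)))
      ≡⟨ ∑-cong (properColorings G k) (λ c → trans (length-filterᵇ _ (properColorings G k)) (∑-filterᵇ (isProper G) (allMaps n k) _)) ⟩
    ∑ (properColorings G k) (λ c → ∑ᶜ n k (λ d → 𝟙 (isProper G d) * 𝟙 (isOne (diffCount c d))))
      ≡⟨ ∑-filterᵇ (isProper G) (allMaps n k) _ ⟩
    ∑ᶜ n k (λ c → 𝟙 (isProper G c) * ∑ᶜ n k (λ d → 𝟙 (isProper G d) * 𝟙 (isOne (diffCount c d))))
      ≡⟨ ∑-cong (allMaps n k) (λ c → cong (𝟙 (isProper G c) *_) (∑-adjacent c (𝟙 ∘ isProper G) (λ d d′ d≗d′ → cong 𝟙 (isProper-cong G d≗d′)))) ⟩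
    ∑ᶜ n k (λ c → 𝟙 (isProper G c) * ∑ᶠ n (λ v → ∑ᶠ k (λ b → 𝟙 (not (c v == b)) * 𝟙 (isProper G (c [ v ↦ b ])))))
      ≡⟨ ∑-cong (allMaps n k) (λ c → trans (∑-*ˡ (allFin n) (𝟙 (isProper G c)) _) (∑-cong (allFin n) (λ v → ∑-*ˡ (allFin k) (𝟙 (isProper G c)) _))) ⟩
    ∑ᶜ n k (λ c → ∑ᶠ n (λ v → ∑ᶠ k (λ b → 𝟙 (isProper G c) * (𝟙 (not (c v == b)) * 𝟙 (isProper G (c [ v ↦ b ]))))))
      ≡⟨ trans (∑-comm (allMaps n k) (allFin n) _) (∑-cong (allFin n) (λ v → ∑-comm (allMaps n k) (allFin k) _)) ⟩
    ∑ᶠ n (λ v → ∑ᶠ k (λ b → ∑ᶜ n k (λ c → 𝟙 (isProper G c) * (𝟙 (not (c v == b)) * 𝟙 (isProper G (c [ v ↦ b ]))))))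
      ≡⟨ ∑-cong (allFin n) (λ v → ∑-cong (allFin k) (∑-flips v)) ⟩
    ∑ᶠ n (λ v → ∑ᶠ k (λ b → ∑ᶠ k (λ a → 𝟙 (not (a == b)) * flips G k v a b))) ∎
    where open ≡-Reasoning

transpose-matchˡ : ∀ {k} (i j : Fin k) → transpose i j ⟨$⟩ʳ i ≡ j
transpose-matchˡ i j rewrite dec-true (i ≟ i) refl = refl

transpose-other : ∀ {k} {i j l : Fin k} → l ≢ i → l ≢ j → transpose i j ⟨$⟩ʳ l ≡ l
transpose-other {i = i} {j} {l} l≢i l≢j rewrite dec-false (l ≟ i) l≢i | dec-false (l ≟ j) l≢j = refl

permutation-injective : ∀ {k} (π : Permutation′ k) {x y} → π ⟨$⟩ʳ x ≡ π ⟨$⟩ʳ y → x ≡ y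
permutation-injective π {x} {y} eq = trans (sym (inverseˡ π)) (trans (cong (π ⟨$⟩ˡ_) eq) (inverseˡ π))

==-permute : ∀ {k} (π : Permutation′ k) x y → ((π ⟨$⟩ʳ x) == (π ⟨$⟩ʳ y)) ≡ (x == y)
==-permute π x y = ≟-elim x y (λ { refl → trans (==-refl _) (sym (==-refl x)) })
  (λ x≢y → trans (≢⇒==false (x≢y ∘ permutation-injective π)) (sym (≢⇒==false x≢y)))

permuteOn : ∀ {n k} → (Fin n → Bool) → Permutation′ k → Colouring n k → Colouring n k
permuteOn R π c w = if R w then π ⟨$⟩ʳ c w else c w

permuteOn-cong : ∀ {n k} (R : Fin n → Bool) (π : Permutation′ k) (c d : Colouring n k) → c ≗ d → permuteOn R π c ≗ permuteOn R π d
permuteOn-cong R π c d c≗d w with R w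
... | true  = cong (π ⟨$⟩ʳ_) (c≗d w)
... | false = c≗d w

module _ {n k : ℕ} (R : Fin n → Bool) (π : Permutation′ k) where

  permuteOn-inverseˡ : ∀ c → permuteOn R (flip π) (permuteOn R π c) ≗ c
  permuteOn-inverseˡ c w with R w
  ... | true  = inverseˡ π
  ... | false = refl

  permuteOn-inverseʳ : ∀ c → permuteOn R π (permuteOn R (flip π) c) ≗ c
  permuteOn-inverseʳ c w with R w
  ... | true  = inverseʳ π
  ... | false = refl

  permuteOn-[↦] : ∀ c v b → R v ≡ false → permuteOn R π (c [ v ↦ b ]) ≗ (permuteOn R π c) [ v ↦ b ]
  permuteOn-[↦] c v b Rv w = ≟-elim w v
    (λ { refl → trans (cong (λ x → if x then π ⟨$⟩ʳ (c [ w ↦ b ]) w else (c [ w ↦ b ]) w) Rv)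
                      (trans ([↦]-at c w b) (sym ([↦]-at (permuteOn R π c) w b))) })
    (λ w≢v → trans (cong (λ x → if R w then π ⟨$⟩ʳ x else x) ([↦]-elsewhere c b w≢v)) (sym ([↦]-elsewhere (permuteOn R π c) b w≢v)))

  ∑ᶜ-permuteOn : (F : Colouring n k → ℕ) → Extensional F → ∑ᶜ n k (F ∘ permuteOn R π) ≡ ∑ᶜ n k F
  ∑ᶜ-permuteOn = ∑ᶜ-bijection n k (permuteOn R π) (permuteOn R (flip π))
    (permuteOn-cong R π) (permuteOn-cong R (flip π)) permuteOn-inverseˡ permuteOn-inverseʳ

module _ {n k : ℕ} (G : Graph n) {R : Fin n → Bool} (R-closed : AdjacencyClosed G R) where

  permuteOn-Proper : ∀ (π : Permutation′ k) {c} → Proper G c → Proper G (permuteOn R π c)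
  permuteOn-Proper π proper i j i~j with R i in Rᵢ | R j in Rⱼ
  ... | true  | true  = proper i j i~j ∘ permutation-injective π
  ... | false | false = proper i j i~j
  ... | true  | false = contradiction (trans (sym Rᵢ) (trans (R-closed i j i~j) Rⱼ)) λ ()
  ... | false | true  = contradiction (trans (sym Rᵢ) (trans (R-closed i j i~j) Rⱼ)) λ ()

  permuteOn-isProper : ∀ (π : Permutation′ k) c → isProper G (permuteOn R π c) ≡ isProper G c
  permuteOn-isProper π c = ⇔-true⇒≡
    (λ p → isProper-complete G c (Proper-resp-≗ G (permuteOn-inverseˡ R π c) (permuteOn-Proper (flip π) (isProper-sound G _ p))))
    (λ p → isProper-complete G _ (permuteOn-Proper π (isProper-sound G c p)))

module _ {n : ℕ} (G : Graph n) (k : ℕ) where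

  flips-permute : ∀ (π : Permutation′ k) v a b → flips G k v (π ⟨$⟩ʳ a) (π ⟨$⟩ʳ b) ≡ flips G k v a b
  flips-permute π v a b = trans (sym (∑ᶜ-permuteOn everywhere π _ (isFlip-extensional G v _ _))) (∑-cong (allMaps n k) λ c →
    cong 𝟙 (cong₂ _∧_ (permuteOn-isProper G closed π c) (cong₂ _∧_ (==-permute π (c v) a)
      (trans (isProper-cong G (λ w → sym (permuteOn-[↦]′ c w))) (permuteOn-isProper G closed π (c [ v ↦ b ]))))))
    where
    everywhere : Fin n → Bool
    everywhere _ = true
    closed : AdjacencyClosed G everywhere
    closed _ _ _ = refl
    permuteOn-[↦]′ : ∀ c w → permuteOn everywhere π (c [ v ↦ b ]) w ≡ (permuteOn everywhere π c [ v ↦ π ⟨$⟩ʳ b ]) w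
    permuteOn-[↦]′ c w with w == v
    ... | true  = refl
    ... | false = refl

  -- Permuting colours on a union of components avoiding v moves the colour of i freely, so each of the k values of
  -- c i contributes equally.
  flips-divisible : ∀ {R : Fin n → Bool} → AdjacencyClosed G R → ∀ {v i} → R v ≡ false → R i ≡ true → ∀ a b →
    k ∣ flips G k v a b
  flips-divisible {R} R-closed {v} {i} Rv Rᵢ a b = divides (∑ᶜ n k (M a)) (begin
    flips G k v a b                                   ≡⟨ ∑-cong (allMaps n k) (λ c → sym (∑ᶠ-δ k (c i) (λ _ → 𝟙 (isFlip G v a b c)))) ⟩
    ∑ᶜ n k (λ c → ∑ᶠ k (λ x → M x c))              ≡⟨ ∑-comm (allMaps n k) (allFin k) _ ⟩
    ∑ᶠ k (λ x → ∑ᶜ n k (M x))                      ≡⟨ ∑-cong (allFin k) same ⟩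
    ∑ᶠ k (λ _ → ∑ᶜ n k (M a))                      ≡⟨ ∑ᶠ-const k _ ⟩
    k * ∑ᶜ n k (M a)                                 ≡⟨ *-comm k _ ⟩
    ∑ᶜ n k (M a) * k ∎)
    where
    open ≡-Reasoning
    M : Fin k → Colouring n k → ℕ
    M x c = 𝟙 (x == c i) * 𝟙 (isFlip G v a b c)
    same : ∀ x → ∑ᶜ n k (M x) ≡ ∑ᶜ n k (M a)
    same x = trans (∑-cong (allMaps n k) (λ c → sym (moved c)))
                   (∑ᶜ-permuteOn R π (M a) (extensional-* (λ c d c≗d → cong (λ y → 𝟙 (a == y)) (c≗d i)) (isFlip-extensional G v a b)))
      where
      π = transpose x a
      moved : ∀ c → M a (permuteOn R π c) ≡ M x c
      moved c = cong₂ _*_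
        (cong 𝟙 (trans (cong₂ _==_ (sym (transpose-matchˡ x a)) (cong (λ y → if y then _ else _) Rᵢ)) (==-permute π x (c i))))
        (cong 𝟙 (cong₂ _∧_ (permuteOn-isProper G R-closed π c) (cong₂ _∧_ (cong (λ y → (if y then _ else _) == a) Rv)
          (trans (isProper-cong G (λ w → sym (permuteOn-[↦] R π c v b Rv w))) (permuteOn-isProper G R-closed π (c [ v ↦ b ]))))))

flips≡flips₀₁ : ∀ {n} (G : Graph n) k v (a b : Fin (2 + k)) → a ≢ b → flips G (2 + k) v a b ≡ flips G (2 + k) v zero (suc zero)
flips≡flips₀₁ G k v a b a≢b = begin
  flips G (2 + k) v a b                       ≡⟨ sym (flips-permute G _ τ₁ v a b) ⟩
  flips G (2 + k) v (τ₁ ⟨$⟩ʳ a) s            ≡⟨ cong (λ x → flips G (2 + k) v x s) (transpose-matchˡ a zero) ⟩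
  flips G (2 + k) v zero s                    ≡⟨ sym (flips-permute G _ τ₂ v zero s) ⟩
  flips G (2 + k) v (τ₂ ⟨$⟩ʳ zero) (τ₂ ⟨$⟩ʳ s) ≡⟨ cong₂ (flips G (2 + k) v) (transpose-other (s≢0 ∘ sym) λ ()) (transpose-matchˡ s (suc zero)) ⟩
  flips G (2 + k) v zero (suc zero) ∎
  where
  open ≡-Reasoning
  τ₁ = transpose a zero
  s  = τ₁ ⟨$⟩ʳ b
  τ₂ = transpose s (suc zero)
  s≢0 : s ≢ zero
  s≢0 s≡0 = a≢b (permutation-injective τ₁ (trans (transpose-matchˡ a zero) (sym s≡0)))

term≤∑ᶜ : ∀ n k {F : Colouring n k → ℕ} → Extensional F → ∀ c → F c ≤ ∑ᶜ n k F
term≤∑ᶜ n k {F} F-ext c = begin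
  F c                                  ≡⟨ sym (∑ᶜ-δ n k c F F-ext) ⟩
  ∑ᶜ n k (λ d → 𝟙 (eqᶜ d c) * F d)    ≤⟨ ∑-mono-≤ (allMaps n k) (λ d → 𝟙*≤ (eqᶜ d c) (F d)) ⟩
  ∑ᶜ n k F ∎
  where
  open ≤-Reasoning
  𝟙*≤ : ∀ b m → 𝟙 b * m ≤ m
  𝟙*≤ true  m = ≤-reflexive (+-identityʳ m)
  𝟙*≤ false m = z≤n

∑ᶜ-mono-< : ∀ n k {F H : Colouring n k → ℕ} → Extensional F → Extensional H → (∀ c → F c ≤ H c) →
  ∀ c → F c < H c → ∑ᶜ n k F < ∑ᶜ n k H
∑ᶜ-mono-< n k {F} {H} F-ext H-ext F≤H c F<H = begin-strict
  ∑ᶜ n k F                              <⟨ m<m+n (∑ᶜ n k F) (<-≤-trans (m<n⇒0<n∸m F<H) (term≤∑ᶜ n k gap-ext c)) ⟩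
  ∑ᶜ n k F + ∑ᶜ n k (λ d → H d ∸ F d)  ≡⟨ sym (∑-+ (allMaps n k) F _) ⟩
  ∑ᶜ n k (λ d → F d + (H d ∸ F d))      ≡⟨ ∑-cong (allMaps n k) (λ d → m+[n∸m]≡n (F≤H d)) ⟩
  ∑ᶜ n k H ∎
  where
  open ≤-Reasoning
  gap-ext : Extensional (λ d → H d ∸ F d)
  gap-ext d d′ d≗d′ = cong₂ _∸_ (H-ext d d′ d≗d′) (F-ext d d′ d≗d′)

module _ {n : ℕ} (G : Graph n) (v : Fin n) where

  degree≡∑ : degree G v ≡ ∑ᶠ n (𝟙 ∘ adj G v)
  degree≡∑ = length-filterᵇ (adj G v) (allFin n)

  nonNeighbours : ℕ
  nonNeighbours = ∑ᶠ n (λ u → 𝟙 (not (u == v) ∧ not (adj G v u)))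

  nonNeighbours+1+degree : nonNeighbours + 1 + degree G v ≡ n
  nonNeighbours+1+degree = begin
    nonNeighbours + 1 + degree G v
      ≡⟨ cong₂ (λ a b → nonNeighbours + a + b) (sym (count-== n v)) degree≡∑ ⟩
    nonNeighbours + ∑ᶠ n (λ u → 𝟙 (u == v)) + ∑ᶠ n (𝟙 ∘ adj G v)
      ≡⟨ cong (_+ ∑ᶠ n (𝟙 ∘ adj G v)) (sym (∑-+ (allFin n) _ _)) ⟩
    ∑ᶠ n (λ u → 𝟙 (not (u == v) ∧ not (adj G v u)) + 𝟙 (u == v)) + ∑ᶠ n (𝟙 ∘ adj G v)
      ≡⟨ sym (∑-+ (allFin n) _ _) ⟩
    ∑ᶠ n (λ u → 𝟙 (not (u == v) ∧ not (adj G v u)) + 𝟙 (u == v) + 𝟙 (adj G v u))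
      ≡⟨ trans (∑-cong (allFin n) one-of) (trans (∑ᶠ-const n 1) (*-identityʳ n)) ⟩
    n ∎
    where
    open ≡-Reasoning
    one-of : ∀ u → 𝟙 (not (u == v) ∧ not (adj G v u)) + 𝟙 (u == v) + 𝟙 (adj G v u) ≡ 1
    one-of u with u == v in u==v | adj G v u in v~u
    ... | true  | true  = contradiction (trans (sym v~u) (trans (cong (adj G v) (==⇒≡ u==v)) (Graph.irrefl G v))) λ ()
    ... | true  | false = refl
    ... | false | true  = refl
    ... | false | false = refl

  nonNeighbours≡ : nonNeighbours ≡ n ∸ degree G v ∸ 1
  nonNeighbours≡ = sym (begin
    n ∸ degree G v ∸ 1                                  ≡⟨ cong (λ m → m ∸ degree G v ∸ 1) (sym nonNeighbours+1+degree) ⟩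
    nonNeighbours + 1 + degree G v ∸ degree G v ∸ 1     ≡⟨ cong (_∸ 1) (m+n∸n≡m (nonNeighbours + 1) (degree G v)) ⟩
    nonNeighbours + 1 ∸ 1                               ≡⟨ m+n∸n≡m nonNeighbours 1 ⟩
    nonNeighbours ∎)
    where open ≡-Reasoning

  degree+nonNeighbours : degree G v + (n ∸ degree G v ∸ 1) ≡ n ∸ 1
  degree+nonNeighbours = trans (cong (degree G v +_) (sym nonNeighbours≡)) (cong (_∸ 1) (trans
    (solve 2 (λ d m → con 1 :+ (d :+ m) := m :+ con 1 :+ d) refl (degree G v) nonNeighbours) nonNeighbours+1+degree))

transpose-self : ∀ {k} (i x : Fin k) → transpose i i ⟨$⟩ˡ x ≡ x
transpose-self i x = ≟-elim x i (λ { refl → transpose-matchˡ x x }) (λ x≢i → transpose-other x≢i x≢i)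

transpose-⟨$⟩ˡ-target : ∀ {k} (i j : Fin k) → transpose i j ⟨$⟩ˡ j ≡ i
transpose-⟨$⟩ˡ-target i j = trans (cong (transpose i j ⟨$⟩ˡ_) (sym (transpose-matchˡ i j))) (inverseˡ (transpose i j))

-- Tree-compatible colourings relax the flips of r from 0 to 1 to the edges of the spanning tree; for a tree they coincide.
module TreeColourings {n : ℕ} {G : Graph n} {r : Fin n} (T : SpanningTree G r) (k : ℕ) where
  open SpanningTree T
  open TreeEdges T

  one : Fin (2 + k)
  one = suc zero

  avoidsOne : Fin n → Fin (2 + k) → Bool
  avoidsOne u x = if adj G r u then not (x == one) else true

  treeConstraint : Colouring n (2 + k) → Fin n → Bool
  treeConstraint c u = if u == r then c u == zero else not (c u == c (parent u)) ∧ avoidsOne u (c u)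

  treeCompatible : Colouring n (2 + k) → Bool
  treeCompatible c = allᶠ n (treeConstraint c)

  allowed : Fin n → Fin (2 + k) → Bool
  allowed u x = if u == r then x == zero else not (x == zero) ∧ avoidsOne u x

  treeConstraint-root : ∀ c → treeConstraint c r ≡ (c r == zero)
  treeConstraint-root c rewrite ==-refl r = refl

  treeConstraint-nonroot : ∀ c {u} → u ≢ r → treeConstraint c u ≡ not (c u == c (parent u)) ∧ avoidsOne u (c u)
  treeConstraint-nonroot c u≢r rewrite ≢⇒==false u≢r = refl

  allowed-root : ∀ x → allowed r x ≡ (x == zero)
  allowed-root x rewrite ==-refl r = refl

  allowed-nonroot : ∀ {u} x → u ≢ r → allowed u x ≡ not (x == zero) ∧ avoidsOne u x
  allowed-nonroot x u≢r rewrite ≢⇒==false u≢r = refl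

  treeCompatible-extensional : Extensional (𝟙 ∘ treeCompatible)
  treeCompatible-extensional c d c≗d = cong 𝟙 (allᶠ-cong n same)
    where
    same : ∀ u → treeConstraint c u ≡ treeConstraint d u
    same u with u == r
    ... | true  = cong (_== zero) (c≗d u)
    ... | false = cong₂ (λ x y → not (x == y) ∧ avoidsOne u x) (c≗d u) (c≗d (parent u))

  count-allowed : ∀ u → ∑ᶠ (2 + k) (𝟙 ∘ allowed u) ≡ k ^ 𝟙 (adj G r u) * suc k ^ 𝟙 (not (u == r) ∧ not (adj G r u))
  count-allowed u = ≟-elim u r
    (λ { refl → begin
      ∑ᶠ (2 + k) (𝟙 ∘ allowed u)   ≡⟨ ∑-cong (allFin (2 + k)) (cong 𝟙 ∘ allowed-root) ⟩
      ∑ᶠ (2 + k) (λ x → 𝟙 (x == zero)) ≡⟨ count-== (2 + k) zero ⟩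
      1                              ≡⟨ cong₂ (λ a b → k ^ 𝟙 a * suc k ^ 𝟙 (not b ∧ not a)) (sym (Graph.irrefl G u)) (sym (==-refl u)) ⟩
      k ^ 𝟙 (adj G u u) * suc k ^ 𝟙 (not (u == u) ∧ not (adj G u u)) ∎ })
    (λ u≢r → trans (∑-cong (allFin (2 + k)) (λ x → cong 𝟙 (allowed-nonroot x u≢r))) (nonroot u≢r))
    where
    open ≡-Reasoning
    nonroot : u ≢ r → ∑ᶠ (2 + k) (λ x → 𝟙 (not (x == zero) ∧ avoidsOne u x))
                    ≡ k ^ 𝟙 (adj G r u) * suc k ^ 𝟙 (not (u == r) ∧ not (adj G r u))
    nonroot u≢r rewrite ≢⇒==false u≢r with adj G r u
    ... | true  = trans (count-≢₂ (2 + k) zero one λ ()) (sym (trans (*-identityʳ (k * 1)) (*-identityʳ k)))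
    ... | false = trans (∑-cong (allFin (2 + k)) (λ x → cong 𝟙 (∧-identityʳ (not (x == zero)))))
                        (trans (count-≢ (2 + k) zero) (sym (trans (*-identityˡ _) (*-identityʳ (suc k)))))

  -- encode c records at each non-root vertex its colour relative to its parent's, the parent's colour becoming 0.
  encode : Colouring n (2 + k) → Colouring n (2 + k)
  encode c u = if u == r then c u else transpose (c (parent u)) zero ⟨$⟩ʳ c u

  decodeWithin : ℕ → Colouring n (2 + k) → Colouring n (2 + k)
  decodeWithin zero    g u = g u
  decodeWithin (suc t) g u = if u == r then g u else transpose (decodeWithin t g (parent u)) zero ⟨$⟩ˡ g u

  decode : Colouring n (2 + k) → Colouring n (2 + k)
  decode = decodeWithin (suc n)

  encode-root : ∀ c → encode c r ≡ c r
  encode-root c rewrite ==-refl r = refl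

  encode-nonroot : ∀ c {u} → u ≢ r → encode c u ≡ transpose (c (parent u)) zero ⟨$⟩ʳ c u
  encode-nonroot c u≢r rewrite ≢⇒==false u≢r = refl

  decodeWithin-root : ∀ t g → decodeWithin (suc t) g r ≡ g r
  decodeWithin-root t g rewrite ==-refl r = refl

  decodeWithin-nonroot : ∀ t g {u} → u ≢ r → decodeWithin (suc t) g u ≡ transpose (decodeWithin t g (parent u)) zero ⟨$⟩ˡ g u
  decodeWithin-nonroot t g u≢r rewrite ≢⇒==false u≢r = refl

  decodeWithin-stable : ∀ s t g u → rank u < s → rank u < t → decodeWithin s g u ≡ decodeWithin t g u
  decodeWithin-stable (suc s) (suc t) g u (s≤s rank≤s) (s≤s rank≤t) = ≟-elim u r
    (λ { refl → trans (decodeWithin-root s g) (sym (decodeWithin-root t g)) })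
    (λ u≢r → trans (decodeWithin-nonroot s g u≢r) (trans
      (cong (λ x → transpose x zero ⟨$⟩ˡ g u) (decodeWithin-stable s t g (parent u)
        (≤-trans (parent-rank u u≢r) rank≤s) (≤-trans (parent-rank u u≢r) rank≤t)))
      (sym (decodeWithin-nonroot t g u≢r))))

  decode-root : ∀ g → decode g r ≡ g r
  decode-root = decodeWithin-root n

  decode-nonroot : ∀ g {u} → u ≢ r → decode g u ≡ transpose (decode g (parent u)) zero ⟨$⟩ˡ g u
  decode-nonroot g {u} u≢r = trans (decodeWithin-nonroot n g u≢r) (cong (λ x → transpose x zero ⟨$⟩ˡ g u)
    (decodeWithin-stable n (suc n) g (parent u) (≤-trans (parent-rank u u≢r) (rank-≤ u)) (s≤s (rank-≤ (parent u)))))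

  encode-decode : ∀ g → encode (decode g) ≗ g
  encode-decode g u = ≟-elim u r
    (λ { refl → trans (encode-root (decode g)) (decode-root g) })
    (λ u≢r → trans (encode-nonroot (decode g) u≢r) (trans (cong (transpose (decode g (parent u)) zero ⟨$⟩ʳ_) (decode-nonroot g u≢r)) (inverseʳ (transpose (decode g (parent u)) zero))))

  decodeWithin-encode : ∀ c t u → rank u < t → decodeWithin t (encode c) u ≡ c u
  decodeWithin-encode c (suc t) u (s≤s rank≤t) = ≟-elim u r
    (λ { refl → trans (decodeWithin-root t (encode c)) (encode-root c) })
    (λ u≢r → trans (decodeWithin-nonroot t (encode c) u≢r) (trans
      (cong₂ (λ x y → transpose x zero ⟨$⟩ˡ y) (decodeWithin-encode c t (parent u) (≤-trans (parent-rank u u≢r) rank≤t)) (encode-nonroot c u≢r))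
      (inverseˡ (transpose (c (parent u)) zero))))

  decode-encode : ∀ c → decode (encode c) ≗ c
  decode-encode c u = decodeWithin-encode c (suc n) u (s≤s (rank-≤ u))

  encode-cong : ∀ c d → c ≗ d → encode c ≗ encode d
  encode-cong c d c≗d u with u == r
  ... | true  = c≗d u
  ... | false = cong₂ (λ x y → transpose x zero ⟨$⟩ʳ y) (c≗d (parent u)) (c≗d u)

  decode-cong : ∀ g h → g ≗ h → decode g ≗ decode h
  decode-cong g h g≗h = go (suc n)
    where
    go : ∀ t → decodeWithin t g ≗ decodeWithin t h
    go zero    u = g≗h u
    go (suc t) u with u == r
    ... | true  = g≗h u
    ... | false = cong₂ (λ x y → transpose x zero ⟨$⟩ˡ y) (go t (parent u)) (g≗h u)

  -- Relative to the parent, "different from the parent's colour" becomes "different from 0".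
  treeConstraint-decode : ∀ g → g r ≡ zero → ∀ u → treeConstraint (decode g) u ≡ allowed u (g u)
  treeConstraint-decode g g-root u = ≟-elim u r
    (λ { refl → trans (treeConstraint-root (decode g)) (trans (cong (_== zero) (decode-root g)) (sym (allowed-root (g u)))) })
    (λ u≢r → trans (treeConstraint-nonroot (decode g) u≢r) (trans
      (cong₂ (λ x y → not x ∧ y) (parent-colour u≢r) (neighbour-of-root u≢r)) (sym (allowed-nonroot (g u) u≢r))))
    where
    parent-colour : u ≢ r → (decode g u == decode g (parent u)) ≡ (g u == zero)
    parent-colour u≢r = trans (cong₂ _==_ (decode-nonroot g u≢r) (sym (transpose-⟨$⟩ˡ-target (decode g (parent u)) zero)))
                              (==-permute (flip (transpose (decode g (parent u)) zero)) (g u) zero)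
    neighbour-of-root : u ≢ r → avoidsOne u (decode g u) ≡ avoidsOne u (g u)
    neighbour-of-root u≢r with adj G r u in r~u
    ... | false = refl
    ... | true  = cong (λ x → not (x == one)) (trans (decode-nonroot g u≢r) (trans
      (cong (λ x → transpose x zero ⟨$⟩ˡ g u) (trans (cong (decode g) (parent-root u (Adjacent-sym G r~u))) (trans (decode-root g) g-root)))
      (transpose-self zero (g u))))

  treeCompatible-decode : ∀ g → 𝟙 (treeCompatible (decode g)) ≡ ∏ᶠ n (λ u → 𝟙 (allowed u (g u)))
  treeCompatible-decode g = trans (cong 𝟙 same) (sym (∏ᶠ-𝟙 n (λ u → allowed u (g u))))
    where
    same : treeCompatible (decode g) ≡ allᶠ n (λ u → allowed u (g u))
    same with g r == zero in g-root
    ... | true  = allᶠ-cong n (treeConstraint-decode g (==⇒≡ g-root))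
    ... | false = trans (allᶠ-false n _ r (trans (treeConstraint-root (decode g)) (trans (cong (_== zero) (decode-root g)) g-root)))
                        (sym (allᶠ-false n _ r (trans (allowed-root (g r)) g-root)))

  count-treeCompatible : ∑ᶜ n (2 + k) (𝟙 ∘ treeCompatible) ≡ k ^ degree G r * suc k ^ (n ∸ degree G r ∸ 1)
  count-treeCompatible = begin
    ∑ᶜ n (2 + k) (𝟙 ∘ treeCompatible)
      ≡⟨ sym (∑ᶜ-bijection n (2 + k) decode encode decode-cong encode-cong encode-decode decode-encode _ treeCompatible-extensional) ⟩
    ∑ᶜ n (2 + k) (𝟙 ∘ treeCompatible ∘ decode)
      ≡⟨ ∑-cong (allMaps n (2 + k)) treeCompatible-decode ⟩
    ∑ᶜ n (2 + k) (λ g → ∏ᶠ n (λ u → 𝟙 (allowed u (g u))))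
      ≡⟨ ∑ᶜ-product n (2 + k) allowed ⟩
    ∏ᶠ n (λ u → ∑ᶠ (2 + k) (𝟙 ∘ allowed u))
      ≡⟨ ∏ᶠ-cong n count-allowed ⟩
    ∏ᶠ n (λ u → k ^ 𝟙 (adj G r u) * suc k ^ 𝟙 (not (u == r) ∧ not (adj G r u)))
      ≡⟨ ∏ᶠ-^ n k (suc k) (adj G r) (λ u → not (u == r) ∧ not (adj G r u)) ⟩
    k ^ ∑ᶠ n (𝟙 ∘ adj G r) * suc k ^ nonNeighbours G r
      ≡⟨ cong₂ (λ a b → k ^ a * suc k ^ b) (sym (degree≡∑ G r)) (nonNeighbours≡ G r) ⟩
    k ^ degree G r * suc k ^ (n ∸ degree G r ∸ 1) ∎
    where open ≡-Reasoning

  isFlip⇒treeCompatible : ∀ c → isFlip G r zero one c ≡ true → treeCompatible c ≡ true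
  isFlip⇒treeCompatible c flip = allᶠ-complete n _ λ u → ≟-elim u r
    (λ { refl → trans (treeConstraint-root c) c-root })
    (λ u≢r → trans (treeConstraint-nonroot c u≢r) (cong₂ _∧_
      (cong not (≢⇒==false (proper u (parent u) (parent-adj u u≢r))))
      (avoids u≢r)))
    where
    proper = isProper-sound G c (proj₁ (∧-true⁻ flip))
    c-root = proj₁ (∧-true⁻ (proj₂ (∧-true⁻ {isProper G c} flip)))
    proper′ = isProper-sound G (c [ r ↦ one ]) (proj₂ (∧-true⁻ (proj₂ (∧-true⁻ {isProper G c} flip))))
    avoids : ∀ {u} → u ≢ r → avoidsOne u (c u) ≡ true
    avoids {u} u≢r with adj G r u in r~u
    ... | false = refl
    ... | true  = cong not (≢⇒==false λ cu≡1 → proper′ r u r~u (trans ([↦]-at c r one) (trans (sym cu≡1) (sym ([↦]-elsewhere c one u≢r)))))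

  treeCompatible⇒isFlip : (∀ {x y} → Adjacent G x y → TreeEdge x y) → ∀ c → treeCompatible c ≡ true → isFlip G r zero one c ≡ true
  treeCompatible⇒isFlip tree c compatible =
    cong₂ _∧_ (isProper-complete G c proper) (cong₂ _∧_ (trans (sym (treeConstraint-root c)) (holds r)) (isProper-complete G (c [ r ↦ one ]) proper′))
    where
    holds = allᶠ-sound n _ compatible
    facts : ∀ {u} → u ≢ r → c u ≢ c (parent u) × (Adjacent G r u → c u ≢ one)
    facts {u} u≢r with ∧-true⁻ {not (c u == c (parent u))} (trans (sym (treeConstraint-nonroot c u≢r)) (holds u))
    ... | differs , avoids =
      (λ eq → contradiction (trans (sym differs) (cong not (trans (cong (_== c (parent u)) eq) (==-refl (c (parent u)))))) λ ()) ,
      (λ r~u eq → contradiction (trans (sym (subst (λ b → (if b then not (c u == one) else true) ≡ true) r~u avoids))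
                                       (cong not (trans (cong (_== one) eq) (==-refl one)))) λ ())
    proper : Proper G c
    proper i j i~j cᵢ≡cⱼ with tree i~j
    ... | inj₁ (i≢r , refl) = proj₁ (facts i≢r) cᵢ≡cⱼ
    ... | inj₂ (j≢r , refl) = proj₁ (facts j≢r) (sym cᵢ≡cⱼ)
    proper′ : Proper G (c [ r ↦ one ])
    proper′ i j i~j eq = ≟-elim i r
      (λ { refl → proj₂ (facts (Adjacent⇒≢ G i~j ∘ sym)) i~j (trans (sym ([↦]-elsewhere c one (Adjacent⇒≢ G i~j ∘ sym))) (trans (sym eq) ([↦]-at c i one))) })
      (λ i≢r → ≟-elim j r
        (λ { refl → proj₂ (facts i≢r) (Adjacent-sym G i~j) (trans (sym ([↦]-elsewhere c one i≢r)) (trans eq ([↦]-at c j one))) })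
        (λ j≢r → proper i j i~j (trans (sym ([↦]-elsewhere c one i≢r)) (trans eq ([↦]-elsewhere c one j≢r)))))

  flips≤treeCompatible : flips G (2 + k) r zero one ≤ ∑ᶜ n (2 + k) (𝟙 ∘ treeCompatible)
  flips≤treeCompatible = ∑-mono-≤ (allMaps n (2 + k)) (λ c → 𝟙-mono (isFlip⇒treeCompatible c))

  flips≡treeCompatible : (∀ {x y} → Adjacent G x y → TreeEdge x y) → flips G (2 + k) r zero one ≡ ∑ᶜ n (2 + k) (𝟙 ∘ treeCompatible)
  flips≡treeCompatible tree = ∑-cong (allMaps n (2 + k)) (λ c → cong 𝟙 (⇔-true⇒≡ (isFlip⇒treeCompatible c) (treeCompatible⇒isFlip tree c)))

-- Colour r with 0, both ends of the non-tree edge with 2 and every other u with 3 + rank u: this respects all tree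
-- constraints, but is not proper.
module Witness {n : ℕ} {G : Graph n} {r : Fin n} (T : SpanningTree G r) {x y : Fin n}
               (x~y : Adjacent G x y) (x≁y : ¬ TreeEdges.TreeEdge T x y) where
  open SpanningTree T
  open TreeEdges T
  open TreeColourings T (2 + n)

  x≢r : x ≢ r
  x≢r refl = x≁y (inj₂ (Adjacent⇒≢ G x~y ∘ sym , parent-root y (Adjacent-sym G x~y)))

  y≢r : y ≢ r
  y≢r refl = x≁y (inj₁ (Adjacent⇒≢ G x~y , parent-root x x~y))

  data Role (u : Fin n) : Set where
    root     : u ≡ r → Role u
    endpoint : u ≢ r → u ≡ x ⊎ u ≡ y → Role u
    other    : u ≢ r → u ≢ x → u ≢ y → Role u

  role : ∀ u → Role u
  role u = ≟-elim u r root λ u≢r → ≟-elim u x (endpoint u≢r ∘ inj₁) λ u≢x → ≟-elim u y (endpoint u≢r ∘ inj₂) (other u≢r u≢x)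

  level : ∀ {u} → Role u → ℕ
  level     (root _)       = 0
  level     (endpoint _ _) = 2
  level {u} (other _ _ _)  = 3 + rank u

  level<colours : ∀ {u} (ρ : Role u) → level ρ < 4 + n
  level<colours (root _)       = s≤s z≤n
  level<colours (endpoint _ _) = s≤s (s≤s (s≤s z≤n))
  level<colours (other _ _ _)  = s≤s (s≤s (s≤s (s≤s (rank-≤ _))))

  witness : Colouring n (4 + n)
  witness u = fromℕ< (level<colours (role u))

  toℕ-witness : ∀ u → toℕ (witness u) ≡ level (role u)
  toℕ-witness u = toℕ-fromℕ< (level<colours (role u))

  level≢1 : ∀ {u} (ρ : Role u) → level ρ ≢ 1
  level≢1 (root _)       ()
  level≢1 (endpoint _ _) ()
  level≢1 (other _ _ _)  ()

  parent≢self : ∀ u → u ≢ r → parent u ≢ u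
  parent≢self u u≢r eq = <-irrefl (cong rank eq) (parent-rank u u≢r)

  level-parent : ∀ u → u ≢ r → level (role u) ≢ level (role (parent u))
  level-parent u u≢r with role u | role (parent u)
  ... | root u≡r             | _                  = ⊥-elim (u≢r u≡r)
  ... | endpoint _ _         | root _             = λ ()
  ... | endpoint _ _         | other _ _ _        = λ ()
  ... | other _ _ _          | root _             = λ ()
  ... | other _ _ _          | endpoint _ _       = λ ()
  ... | other _ _ _          | other _ _ _        = λ eq → <-irrefl (sym (+-cancelˡ-≡ 3 _ _ eq)) (parent-rank u u≢r)
  ... | endpoint _ (inj₁ refl) | endpoint _ (inj₁ p≡x) = λ _ → parent≢self u u≢r p≡x
  ... | endpoint _ (inj₂ refl) | endpoint _ (inj₂ p≡y) = λ _ → parent≢self u u≢r p≡y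
  ... | endpoint _ (inj₁ refl) | endpoint _ (inj₂ p≡y) = λ _ → x≁y (inj₁ (x≢r , p≡y))
  ... | endpoint _ (inj₂ refl) | endpoint _ (inj₁ p≡x) = λ _ → x≁y (inj₂ (y≢r , p≡x))

  witness-treeCompatible : treeCompatible witness ≡ true
  witness-treeCompatible = allᶠ-complete n _ λ u → ≟-elim u r
    (λ { refl → trans (treeConstraint-root witness) (trans (cong (_== zero) (toℕ-injective root-level)) (==-refl (zero {n = 3 + n}))) })
    (λ u≢r → trans (treeConstraint-nonroot witness u≢r) (cong₂ _∧_
      (cong not (≢⇒==false λ eq → level-parent u u≢r (trans (sym (toℕ-witness u)) (trans (cong toℕ eq) (toℕ-witness (parent u))))))
      (avoids u)))
    where
    root-level : toℕ (witness r) ≡ toℕ {4 + n} zero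
    root-level with role r | toℕ-witness r
    ... | root _           | eq = eq
    ... | endpoint r≢r _   | _  = ⊥-elim (r≢r refl)
    ... | other r≢r _ _    | _  = ⊥-elim (r≢r refl)
    avoids : ∀ u → avoidsOne u (witness u) ≡ true
    avoids u with adj G r u
    ... | false = refl
    ... | true  = cong not (≢⇒==false λ eq → level≢1 (role u) (trans (sym (toℕ-witness u)) (cong toℕ eq)))

  witness-¬isFlip : isFlip G r zero one witness ≡ false
  witness-¬isFlip with isProper G witness in proper
  ... | false = refl
  ... | true  = ⊥-elim (isProper-sound G witness proper x y x~y (toℕ-injective (trans (toℕ-witness x) (trans (endpoint-level x (inj₁ refl)) (sym (trans (toℕ-witness y) (endpoint-level y (inj₂ refl))))))))
    where
    endpoint-level : ∀ u → u ≡ x ⊎ u ≡ y → level (role u) ≡ 2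
    endpoint-level u u∈xy with role u
    ... | root refl          = ⊥-elim ([ x≢r ∘ sym , y≢r ∘ sym ]′ u∈xy)
    ... | endpoint _ _       = refl
    ... | other _ u≢x u≢y    = ⊥-elim ([ u≢x , u≢y ]′ u∈xy)

  flips<treeCompatible : flips G (4 + n) r zero one < ∑ᶜ n (4 + n) (𝟙 ∘ treeCompatible)
  flips<treeCompatible = ∑ᶜ-mono-< n (4 + n) (isFlip-extensional G r zero one) treeCompatible-extensional
    (λ c → 𝟙-mono (isFlip⇒treeCompatible c)) witness
    (subst₂ _<_ (sym (cong 𝟙 witness-¬isFlip)) (sym (cong 𝟙 witness-treeCompatible)) (s≤s z≤n))

2*[1+m]C2 : ∀ m → 2 * (suc m C 2) ≡ suc m * m
2*[1+m]C2 zero    = refl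
2*[1+m]C2 (suc m) = begin
  2 * ((2 + m) C 2)               ≡⟨ cong (2 *_) (sym (nCk+nC[k+1]≡[n+1]C[k+1] (suc m) 1)) ⟩
  2 * (suc m C 1 + suc m C 2)     ≡⟨ *-distribˡ-+ 2 (suc m C 1) (suc m C 2) ⟩
  2 * (suc m C 1) + 2 * (suc m C 2) ≡⟨ cong₂ _+_ (cong (2 *_) (nC1≡n (suc m))) (2*[1+m]C2 m) ⟩
  2 * suc m + suc m * m           ≡⟨ solve 1 (λ m → con 2 :* (con 1 :+ m) :+ (con 1 :+ m) :* m := (con 2 :+ m) :* (con 1 :+ m)) refl m ⟩
  (2 + m) * suc m ∎
  where open ≡-Reasoning

0<[2+k]C2 : ∀ k → 0 < (2 + k) C 2
0<[2+k]C2 k with (2 + k) C 2 in eq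
... | zero  = contradiction (trans (sym (2*[1+m]C2 (suc k))) (cong (2 *_) eq)) λ ()
... | suc _ = s≤s z≤n

treeFlips : ∀ {n} → Graph n → ℕ → Fin n → ℕ
treeFlips {n} G k v = (k ∸ 2) ^ degree G v * (k ∸ 1) ^ (n ∸ degree G v ∸ 1)

Formula : ∀ {n} → Graph n → Set
Formula {n} G = ∀ k → chromaticPairs G k ≡ (k C 2) * ∑ᶠ n (treeFlips G k)

module _ {n : ℕ} (G : Graph n) where

  flips₀₁ : ℕ → Fin n → ℕ
  flips₀₁ k v = flips G (2 + k) v zero (suc zero)

  orderedAdjPairs≡ : ∀ k → orderedAdjPairs G (2 + k) ≡ (2 + k) * suc k * ∑ᶠ n (flips₀₁ k)
  orderedAdjPairs≡ k = begin
    orderedAdjPairs G K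
      ≡⟨ orderedAdjPairs≡∑flips G K ⟩
    ∑ᶠ n (λ v → ∑ᶠ K (λ b → ∑ᶠ K (λ a → 𝟙 (not (a == b)) * flips G K v a b)))
      ≡⟨ ∑-cong (allFin n) (λ v → ∑-cong (allFin K) (λ b → trans (∑-cong (allFin K) (λ a → off-diagonal v a b))
           (sym (∑-*ʳ (allFin K) (flips₀₁ k v) (λ a → 𝟙 (not (a == b))))))) ⟩
    ∑ᶠ n (λ v → ∑ᶠ K (λ b → ∑ᶠ K (λ a → 𝟙 (not (a == b))) * flips₀₁ k v))
      ≡⟨ ∑-cong (allFin n) (λ v → trans (∑-cong (allFin K) (λ b → cong (_* flips₀₁ k v) (count-≢ K b)))
           (trans (∑ᶠ-const K (suc k * flips₀₁ k v)) (sym (*-assoc K (suc k) (flips₀₁ k v))))) ⟩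
    ∑ᶠ n (λ v → K * suc k * flips₀₁ k v)
      ≡⟨ sym (∑-*ˡ (allFin n) (K * suc k) (flips₀₁ k)) ⟩
    K * suc k * ∑ᶠ n (flips₀₁ k) ∎
    where
    open ≡-Reasoning
    K = 2 + k
    off-diagonal : ∀ v a b → 𝟙 (not (a == b)) * flips G K v a b ≡ 𝟙 (not (a == b)) * flips₀₁ k v
    off-diagonal v a b = ≟-elim a b
      (λ { refl → trans (cong (λ x → 𝟙 (not x) * flips G K v a a) (==-refl a)) (sym (cong (λ x → 𝟙 (not x) * flips₀₁ k v) (==-refl a))) })
      (λ a≢b → cong (𝟙 (not (a == b)) *_) (flips≡flips₀₁ G k v a b a≢b))

  chromaticPairs≡ : ∀ k → chromaticPairs G (2 + k) ≡ ((2 + k) C 2) * ∑ᶠ n (flips₀₁ k)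
  chromaticPairs≡ k = trans (cong (_/ 2) (trans (orderedAdjPairs≡ k) (trans
    (cong (_* ∑ᶠ n (flips₀₁ k)) (sym (2*[1+m]C2 (suc k))))
    (solve 2 (λ c s → con 2 :* c :* s := c :* s :* con 2) refl ((2 + k) C 2) (∑ᶠ n (flips₀₁ k))))))
    (m*n/n≡m (((2 + k) C 2) * ∑ᶠ n (flips₀₁ k)) 2)

  -- Below two colours there are no proper recolourings at all, and k C 2 vanishes as well.
  formula-<2 : ∀ k → k < 2 → chromaticPairs G k ≡ (k C 2) * ∑ᶠ n (treeFlips G k)
  formula-<2 zero          _ = cong (_/ 2) (trans (orderedAdjPairs≡∑flips G 0) (∑-zero (allFin n)))
  formula-<2 (suc zero)    _ = cong (_/ 2) (trans (orderedAdjPairs≡∑flips G 1) (∑-zero (allFin n)))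
  formula-<2 (suc (suc _)) (s≤s (s≤s ()))

  flips₀₁≤treeFlips : Connected G → ∀ k v → flips₀₁ k v ≤ treeFlips G (2 + k) v
  flips₀₁≤treeFlips connected k v =
    subst (flips₀₁ k v ≤_) (TreeColourings.count-treeCompatible T k) (TreeColourings.flips≤treeCompatible T k)
    where T = BFS.bfsTree G connected v

  tree⇒formula : IsTree G → Formula G
  tree⇒formula _                  0             = formula-<2 0 (s≤s z≤n)
  tree⇒formula _                  1             = formula-<2 1 (s≤s (s≤s z≤n))
  tree⇒formula (connected , acyclic) (suc (suc k)) =
    trans (chromaticPairs≡ k) (cong (((2 + k) C 2) *_) (∑-cong (allFin n) λ v →
      let T = BFS.bfsTree G connected v in
      trans (TreeColourings.flips≡treeCompatible T k (TreeEdges.acyclic⇒TreeEdge T acyclic))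
            (TreeColourings.count-treeCompatible T k)))

  formula⇒∑flips₀₁ : Formula G → ∀ k → ∑ᶠ n (flips₀₁ k) ≡ ∑ᶠ n (treeFlips G (2 + k))
  formula⇒∑flips₀₁ formula k = *-cancelˡ-≡ _ _ ((2 + k) C 2) {{>-nonZero (0<[2+k]C2 k)}}
    (trans (sym (chromaticPairs≡ k)) (formula (2 + k)))

  open Reachability G

  -- If i does not reach j, every vertex v misses one of them, so colours can be permuted on a component avoiding v.
  formula⇒connected : 1 ≤ n → Formula G → Connected G
  formula⇒connected 1≤n formula i j with reaches i j in i⇝j
  ... | true  = Path⇒Walk G (reaches⇒Path i⇝j)
  ... | false with ∑ᶠ n (λ v → 2 ^ degree G v) in ∑2^d | ∑ᶠ-positive n 1≤n (λ v → m^n>0 2 (degree G v))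
  ...   | zero  | ()
  ...   | suc s | _ = ⊥-elim (∤-∑-powers s (n ∸ 1) n (degree G) (λ v → n ∸ degree G v ∸ 1) (degree+nonNeighbours G) ∑2^d
          (subst (3 + s ∣_) (formula⇒∑flips₀₁ formula (suc s)) (∑-∣ (allFin n) λ v → divisible v)))
    where
    unreached : ∀ v → ∃ λ w → reaches w v ≡ false × reaches w w ≡ true
    unreached v with reaches i v in i⇝v | reaches j v in j⇝v
    ... | false | _     = i , i⇝v , reachesWithin-refl n i
    ... | true  | false = j , j⇝v , reachesWithin-refl n j
    ... | true  | true  = contradiction
          (trans (sym i⇝j) (Path⇒reaches (reaches⇒Path i⇝v ◅◅ reverse (Adjacent-sym G) (reaches⇒Path j⇝v)))) λ ()
    divisible : ∀ v → 3 + s ∣ flips₀₁ (suc s) v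
    divisible v = let w , w↛v , w⇝w = unreached v in
      flips-divisible G (3 + s) (reaches-AdjacencyClosed w) w↛v w⇝w zero (suc zero)

  formula⇒acyclic : Formula G → Connected G → Acyclic G
  formula⇒acyclic formula connected cyc = <-irrefl (formula⇒∑flips₀₁ formula (2 + n))
    (∑ᶠ-mono-< n (flips₀₁≤treeFlips connected (2 + n)) r strict)
    where
    r = Cycle.vert cyc zero
    T = BFS.bfsTree G connected r
    strict : flips₀₁ (2 + n) r < treeFlips G (4 + n) r
    strict = let x , y , x~y , x≁y = TreeEdges.cycle⇒nonTreeEdge T cyc in
      subst (flips₀₁ (2 + n) r <_) (TreeColourings.count-treeCompatible T (2 + n)) (Witness.flips<treeCompatible T x~y x≁y)

theorem5p5 : (n : ℕ) → 1 ≤ n → (G : Graph n) →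
    IsTree G ⇔ (∀ (k : ℕ) → chromaticPairs G k
    ≡ (k C 2) * sum (map (λ i → (k ∸ 2) ^ degree G i * (k ∸ 1) ^ (n ∸ degree G i ∸ 1)) (allFin n)))
theorem5p5 n 1≤n G = mk⇔ (tree⇒formula G) λ formula →
  let connected = formula⇒connected G 1≤n formula in connected , formula⇒acyclic G formula connected
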